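{- If $G$ is a connected graph, then $$\mathrm{czf}(G)=\mathrm{cfms}(G)=\mathrm{d}(G)=|V(G)|-\mathrm{mu}(G).$$
   Context: All graphs are finite and simple. Constrained zero forcing: start with a set $S\subseteq V(G)$ of colored vertices, all others uncolored. A colored vertex $c$ may force an uncolored vertex $u$ to become colored if $u$ is the only uncolored neighbor of $c$; only vertices of the initial set $S$ may force. $S$ is a constrained zero forcing set if some sequence of forces colors all vertices. $\mathrm{czf}(G)$ is the minimum size of such a set. Constrained fast-mixed search: initially all vertices and edges are contaminated. Searchers are first placed on distinct vertices (at most one searcher per vertex at any time); then searchers slide: a searcher on $u$ may slide along an edge $uv$ to $v$ if $uv$ is the only contaminated edge incident with $u$, and each searcher slides at most once. An edge is cleared if both its endpoints are simultaneously occupied by searchers, or if a searcher slides along it; a vertex is cleared once it is occupied. $\mathrm{cfms}(G)$ is the minimum number of searchers for which some such strategy clears all edges and vertices of $G$. Deduction: a layout places a nonnegative number of searchers on each vertex; occupied vertices are protected. In stages, a vertex $v$ carrying searchers that have not yet moved (only vertices of the initial layout) and that has not fired before may fire if the number of its unmoved searchers is at least its number of unprotected neighbors; then one searcher moves to each unprotected neighbor (which becomes protected), excess searchers move to arbitrary neighbors or stay, and $v$ does not fire again. $\mathrm{d}(G)$ is the minimum number of searchers in a layout from which all vertices can become protected. A matching $M$ in $G$ has the uniqueness property if there exist disjoint $V_1,V_2\subseteq V(G)$ such that $M$ is the unique perfect matching of the bipartite graph with vertex set $V_1\cup V_2$ consisting of all edges of $G$ between $V_1$ and $V_2$. $\mathrm{mu}(G)$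 is the maximum size of a matching in $G$ with the uniqueness property. -}

module Defs where

open import Data.Nat using (ℕ; zero; suc; _≤_; _<ᵇ_)
open import Data.Bool using (Bool; true; false; _∧_; _∨_; not)
open import Data.Fin using (Fin; toℕ; _≟_)
open import Data.Fin.Subset using (Subset; ∣_∣) renaming (⊥ to ∅)
open import Data.Vec using (Vec; lookup; tabulate; sum; _[_]≔_)
open import Data.Product using (Σ; _×_; _,_)
open import Relation.Binary.PropositionalEquality using (_≡_; _≢_)
open import Relation.Nullary.Decidable using (⌊_⌋)

record Graph (n : ℕ) : Set where
  field
    adj    : Fin n → Fin n → Bool
    sym    : ∀ u v → adj u v ≡ adj v u
    irrefl : ∀ v → adj v v ≡ false
open Graph public

module _ {n : ℕ} (G : Graph n) where

  data Reach : Fin n → Fin n → Set where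
    here : ∀ {u} → Reach u u
    step : ∀ {u w v} → adj G u w ≡ true → Reach w v → Reach u v

  Connected : Set
  Connected = ∀ u v → Reach u v

  -- Constrained zero forcing.  ZFRun S C : starting from the coloured
  -- set C, some sequence of forces (by vertices of S only) colours all.
  data ZFRun (S : Subset n) : Subset n → Set where
    done  : ∀ {C} → (∀ v → lookup C v ≡ true) → ZFRun S C
    force : ∀ {C} (c u : Fin n) →
            lookup S c ≡ true → lookup C c ≡ true → lookup C u ≡ false →
            adj G c u ≡ true →
            (∀ w → adj G c w ≡ true → w ≢ u → lookup C w ≡ true) →
            ZFRun S (C [ u ]≔ true) → ZFRun S C

  IsCZFSet : Subset n → Set
  IsCZFSet S = ZFRun S S

  IsCZF : ℕ → Set
  IsCZF k = Σ (Subset n) (λ S → IsCZFSet S × ∣ S ∣ ≡ k)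
          × (∀ S → IsCZFSet S → k ≤ ∣ S ∣)

  -- Constrained fast-mixed search.
  -- occ: occupied vertices; unm: vertices carrying a searcher that has
  -- not yet slid; clv: cleared vertices; cle: cleared edges.
  record SState : Set where
    constructor sstate
    field
      occ unm clv : Subset n
      cle         : Fin n → Fin n → Bool

  initS : Subset n → SState
  initS S = sstate S S S (λ a b → lookup S a ∧ lookup S b)

  sameEdge : Fin n → Fin n → Fin n → Fin n → Bool
  sameEdge u v a b = (⌊ a ≟ u ⌋ ∧ ⌊ b ≟ v ⌋) ∨ (⌊ a ≟ v ⌋ ∧ ⌊ b ≟ u ⌋)

  slideS : SState → Fin n → Fin n → SState
  slideS (sstate o m c e) u v =
    sstate o' (m [ u ]≔ false) (c [ v ]≔ true)
           (λ a b → e a b ∨ sameEdge u v a b ∨ (lookup o' a ∧ lookup o' b))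
    where
    o' : Subset n
    o' = (o [ u ]≔ false) [ v ]≔ true

  data SRun : SState → Set where
    done  : ∀ {st} →
            (∀ v → lookup (SState.clv st) v ≡ true) →
            (∀ a b → adj G a b ≡ true → SState.cle st a b ≡ true) →
            SRun st
    slide : ∀ {st} (u v : Fin n) →
            lookup (SState.unm st) u ≡ true →
            adj G u v ≡ true →
            lookup (SState.occ st) v ≡ false →
            SState.cle st u v ≡ false →
            (∀ w → adj G u w ≡ true → w ≢ v → SState.cle st u w ≡ true) →
            SRun (slideS st u v) → SRun st

  -- searchers initially placed on the (distinct) vertices of S
  IsCFMSStrategy : Subset n → Set
  IsCFMSStrategy S = SRun (initS S)

  IsCFMS : ℕ → Set
  IsCFMS k = Σ (Subset n) (λ S → IsCFMSStrategy S × ∣ S ∣ ≡ k)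
           × (∀ S → IsCFMSStrategy S → k ≤ ∣ S ∣)

  -- Deduction.  A layout L gives the number of searchers on each vertex.
  positive : ℕ → Bool
  positive zero    = false
  positive (suc _) = true

  unprotNbrs : Subset n → Fin n → ℕ
  unprotNbrs P v = ∣ tabulate (λ w → adj G v w ∧ not (lookup P w)) ∣

  -- DRun L P F : from protected set P and fired set F, some sequence
  -- of firings protects every vertex.
  data DRun (L : Vec ℕ n) : Subset n → Subset n → Set where
    done : ∀ {P F} → (∀ v → lookup P v ≡ true) → DRun L P F
    fire : ∀ {P F} (v : Fin n) →
           positive (lookup L v) ≡ true →
           lookup F v ≡ false →
           unprotNbrs P v ≤ lookup L v →
           DRun L (tabulate (λ w → lookup P w ∨ adj G v w)) (F [ v ]≔ true) →
           DRun L P F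

  IsDLayout : Vec ℕ n → Set
  IsDLayout L = DRun L (tabulate (λ v → positive (lookup L v))) ∅

  IsD : ℕ → Set
  IsD k = Σ (Vec ℕ n) (λ L → IsDLayout L × sum L ≡ k)
        × (∀ L → IsDLayout L → k ≤ sum L)

  EdgeSet : Set
  EdgeSet = Fin n → Fin n → Bool

  esize : EdgeSet → ℕ
  esize M = sum (tabulate (λ u → ∣ tabulate (λ v → M u v ∧ (toℕ u <ᵇ toℕ v)) ∣))

  IsMatchingIn : EdgeSet → EdgeSet → Set
  IsMatchingIn E M =
    (∀ u v → M u v ≡ M v u) ×
    (∀ u v → M u v ≡ true → E u v ≡ true) ×
    (∀ u v w → M u v ≡ true → M u w ≡ true → v ≡ w)

  bipEdges : Subset n → Subset n → EdgeSet
  bipEdges V₁ V₂ u v = adj G u v ∧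
    ((lookup V₁ u ∧ lookup V₂ v) ∨ (lookup V₂ u ∧ lookup V₁ v))

  IsPerfectMatching : Subset n → Subset n → EdgeSet → Set
  IsPerfectMatching V₁ V₂ M =
    IsMatchingIn (bipEdges V₁ V₂) M ×
    (∀ u → (lookup V₁ u ∨ lookup V₂ u) ≡ true → Σ (Fin n) (λ w → M u w ≡ true))

  HasUniqueness : EdgeSet → Set
  HasUniqueness M =
    IsMatchingIn (adj G) M ×
    Σ (Subset n) (λ V₁ → Σ (Subset n) (λ V₂ →
      (∀ v → lookup V₁ v ≡ true → lookup V₂ v ≡ false) ×
      IsPerfectMatching V₁ V₂ M ×
      (∀ M' → IsPerfectMatching V₁ V₂ M' → ∀ u v → M' u v ≡ M u v)))

  IsMU : ℕ → Set
  IsMU m = Σ EdgeSet (λ M → HasUniqueness M × esize M ≡ m)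
         × (∀ M → HasUniqueness M → esize M ≤ m)

module Submission where

-- A constrained zero forcing run from S, read as the list of its forces (c , u), is a triangular
-- sequence: c is adjacent to u but to no vertex forced later. Such a sequence is a matching with the
-- uniqueness property between its forcers and forced vertices, so a run certifies a matching of
-- size n − |S|; a deduction run likewise certifies one of size at least n minus its searchers.
-- Conversely, if M is the unique perfect matching of G[V₁ , V₂], colour everything outside V₂ and
-- let partners force: if this gets stuck, following partners through uncoloured neighbours closes an
-- alternating cycle, and shifting M along it contradicts uniqueness.
-- A fast-mixed search from S clears vertices exactly as zero forcing from S colours them (a slide
-- is a force), and a zero forcing set S is a deduction layout with one searcher on each vertex of S.

open import Algebra.Properties.CommutativeMonoid.Sum as ∑-Props using ()
open import Data.Bool as Bool using (Bool; true; false; _∧_; _∨_; not; if_then_else_)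
open import Data.Bool.Properties using (¬-not; not-injective; ∨-zeroʳ; ∧-zeroʳ; ∨-conicalˡ; ∨-conicalʳ)
open import Data.Empty using (⊥-elim)
open import Data.Fin using (Fin; zero; suc; _≟_; toℕ; fromℕ; fromℕ<)
open import Data.Fin.Properties as Finₚ
  using (toℕ-injective; toℕ-fromℕ; toℕ-fromℕ<; toℕ-inject; any?; all?; ¬∀⟶∃¬; ¬∀⟶∃¬-smallest; pigeonhole)
open import Data.Fin.Subset using (Subset; ∣_∣; ⊤) renaming (⊥ to ∅)
open import Data.Fin.Subset.Properties using (∣⊥∣≡0; ∣⊤∣≡n; ∣p∣≤n; anySubset?)
open import Data.List using (List; []; _∷_; map; length)
open import Data.List.Membership.Propositional using (_∈_; find; lose)
open import Data.List.Membership.Propositional.Properties using (∈-map⁺; ∈-map⁻)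
open import Data.List.Relation.Unary.All as All using (All; []; _∷_)
open import Data.List.Relation.Unary.Any as Any using (here; there)
open import Data.Nat as ℕ using (ℕ; zero; suc; _+_; _*_; _∸_; _≤_; _<ᵇ_; z≤n; s≤s)
open import Data.Nat.DivMod using (_%_; _/_; m≡m%n+[m/n]*n; m%n<n)
open import Data.Nat.GeneralisedArithmetic using (fold; fold-+)
open import Data.Nat.Properties
  using ( +-assoc; +-comm; +-identityʳ; +-suc; +-mono-≤; +-monoˡ-≤; +-monoʳ-≤; +-cancelʳ-≤
        ; *-cancelˡ-≡; suc-injective; 0≢1+n; n<1+n; <⇒≤; ≮⇒≥; ≤-trans; m≤m+n
        ; m∸n+n≡m; m+n∸n≡m; m+[n∸m]≡n; m∸[m∸n]≡n; +-∸-assoc; ∸-monoʳ-≤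
        ; +-0-commutativeMonoid; module ≤-Reasoning)
open import Data.Nat.Tactic.RingSolver using (solve-∀)
open import Data.Product using (Σ; ∃; ∃₂; _×_; _,_; proj₁; proj₂)
open import Data.Sum using (_⊎_; inj₁; inj₂)
open import Data.Vec as Vec using (Vec; lookup; tabulate; _[_]≔_)
open import Data.Vec.Properties using (lookup∘update; lookup∘update′; lookup∘tabulate; lookup-replicate; tabulate∘lookup)
open import Defs renaming (sym to adj-sym)
open import Function using (_∘_)
open import Relation.Binary.Definitions using (DecidableEquality)
open import Relation.Binary.PropositionalEquality
open import Relation.Nullary using (¬_; Dec; yes; no; does)
open import Relation.Nullary.Decidable using (⌊_⌋; dec-true; decidable-stable; _×-dec_; _⊎-dec_; _→-dec_; ¬?)
open import Relation.Unary using (Decidable)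

open ∑-Props +-0-commutativeMonoid using (sum-cong-≗; ∑-distrib-+; ∑-comm; sum-replicate-zero)
  renaming (sum to ∑)

true≢false : true ≢ false
true≢false ()

∨-true : ∀ {x y} → x ∨ y ≡ true → x ≡ true ⊎ y ≡ true
∨-true {true}  _ = inj₁ refl
∨-true {false} e = inj₂ e

∧-true : ∀ {x y} → x ∧ y ≡ true → x ≡ true × y ≡ true
∧-true {true} {true} _ = refl , refl

∨-introˡ : ∀ {x} y → x ≡ true → x ∨ y ≡ true
∨-introˡ _ refl = refl

∨-introʳ : ∀ x {y} → y ≡ true → x ∨ y ≡ true
∨-introʳ true  _    = refl
∨-introʳ false refl = refl

true-≡ : ∀ {x y} → (x ≡ true → y ≡ true) → (y ≡ true → x ≡ true) → x ≡ y
true-≡ {true}  {true}  _ _ = refl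
true-≡ {true}  {false} f _ = sym (f refl)
true-≡ {false} {true}  _ g = g refl
true-≡ {false} {false} _ _ = refl

does-true : ∀ {P : Set} (P? : Dec P) → does P? ≡ true → P
does-true (yes p) _ = p

⌊⌋-true : ∀ {P : Set} (P? : Dec P) → ⌊ P? ⌋ ≡ true → P
⌊⌋-true (yes p) _ = p

≔true-mono : ∀ {n} (C : Subset n) u {v} → lookup C v ≡ true → lookup (C [ u ]≔ true) v ≡ true
≔true-mono C u {v} Cv with u ≟ v
... | yes refl = lookup∘update u C true
... | no u≢v   = trans (lookup∘update′ (≢-sym u≢v) C true) Cv

≔true-false : ∀ {n} (C : Subset n) u {v} → lookup (C [ u ]≔ true) v ≡ false → u ≢ v × lookup C v ≡ false
≔true-false C u {v} C'v with u ≟ v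
... | yes refl = ⊥-elim (true≢false (trans (sym (lookup∘update u C true)) C'v))
... | no u≢v   = u≢v , trans (sym (lookup∘update′ (≢-sym u≢v) C true)) C'v

≔false-true : ∀ {n} (C : Subset n) u {v} → lookup (C [ u ]≔ false) v ≡ true → u ≢ v × lookup C v ≡ true
≔false-true C u {v} C'v with u ≟ v
... | yes refl = ⊥-elim (true≢false (trans (sym C'v) (lookup∘update u C false)))
... | no u≢v   = u≢v , trans (sym (lookup∘update′ (≢-sym u≢v) C false)) C'v

≔true⇒ : ∀ {n} (C : Subset n) u {v} → lookup (C [ u ]≔ true) v ≡ true → u ≡ v ⊎ lookup C v ≡ true
≔true⇒ C u {v} e with u ≟ v
... | yes u≡v = inj₁ u≡v
... | no u≢v  = inj₂ (trans (sym (lookup∘update′ (≢-sym u≢v) C true)) e)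

𝟙 : Bool → ℕ
𝟙 b = if b then 1 else 0

𝟙≤1 : ∀ b → 𝟙 b ≤ 1
𝟙≤1 true  = s≤s z≤n
𝟙≤1 false = z≤n

count : ∀ {n} → (Fin n → Bool) → ℕ
count p = ∑ (𝟙 ∘ p)

∑-cong : ∀ {n} {f g : Fin n → ℕ} → (∀ i → f i ≡ g i) → ∑ f ≡ ∑ g
∑-cong = sum-cong-≗

∑-mono : ∀ {n} {f g : Fin n → ℕ} → (∀ i → f i ≤ g i) → ∑ f ≤ ∑ g
∑-mono {zero}  _ = z≤n
∑-mono {suc n} h = +-mono-≤ (h zero) (∑-mono (h ∘ suc))

sum-tabulate : ∀ {n} (f : Fin n → ℕ) → Vec.sum (tabulate f) ≡ ∑ f
sum-tabulate {zero}  f = refl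
sum-tabulate {suc n} f = cong (f zero +_) (sum-tabulate (f ∘ suc))

sum≡∑lookup : ∀ {n} (L : Vec ℕ n) → Vec.sum L ≡ ∑ (lookup L)
sum≡∑lookup L = trans (cong Vec.sum (sym (tabulate∘lookup L))) (sum-tabulate (lookup L))

∣tabulate∣≡count : ∀ {n} (p : Fin n → Bool) → ∣ tabulate p ∣ ≡ count p
∣tabulate∣≡count {zero}  p = refl
∣tabulate∣≡count {suc n} p with p zero
... | true  = cong suc (∣tabulate∣≡count (p ∘ suc))
... | false = ∣tabulate∣≡count (p ∘ suc)

∣∣≡count : ∀ {n} (C : Subset n) → ∣ C ∣ ≡ count (lookup C)
∣∣≡count C = trans (cong ∣_∣ (sym (tabulate∘lookup C))) (∣tabulate∣≡count (lookup C))

∑-bump : ∀ {n} (f g : Fin n → ℕ) (i : Fin n) {k} → f i ≡ k + g i →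
         (∀ j → j ≢ i → f j ≡ g j) → ∑ f ≡ k + ∑ g
∑-bump {suc n} f g zero {k} fi others = begin
  f zero + ∑ (f ∘ suc)      ≡⟨ cong₂ _+_ fi (∑-cong (λ j → others (suc j) λ ())) ⟩
  k + g zero + ∑ (g ∘ suc)  ≡⟨ +-assoc k _ _ ⟩
  k + ∑ g                   ∎
  where open ≡-Reasoning
∑-bump {suc n} f g (suc i) {k} fi others = begin
  f zero + ∑ (f ∘ suc)        ≡⟨ cong₂ _+_ (others zero λ ()) (∑-bump (f ∘ suc) (g ∘ suc) i fi others-suc) ⟩
  g zero + (k + ∑ (g ∘ suc))  ≡⟨ sym (+-assoc (g zero) k _) ⟩
  g zero + k + ∑ (g ∘ suc)    ≡⟨ cong (_+ ∑ (g ∘ suc)) (+-comm (g zero) k) ⟩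
  k + g zero + ∑ (g ∘ suc)    ≡⟨ +-assoc k _ _ ⟩
  k + ∑ g                     ∎
  where
  open ≡-Reasoning
  others-suc : ∀ j → j ≢ i → f (suc j) ≡ g (suc j)
  others-suc j j≢i = others (suc j) (j≢i ∘ Finₚ.suc-injective)

∑-single : ∀ {n} (f : Fin n → ℕ) (i : Fin n) → (∀ j → j ≢ i → f j ≡ 0) → ∑ f ≡ f i
∑-single {n} f i others = begin
  ∑ f                    ≡⟨ ∑-bump f (λ _ → 0) i (sym (+-identityʳ (f i))) others ⟩
  f i + ∑ {n} (λ _ → 0)  ≡⟨ cong (f i +_) (sum-replicate-zero n) ⟩
  f i + 0                ≡⟨ +-identityʳ (f i) ⟩
  f i                    ∎
  where open ≡-Reasoning

∑∑-double : ∀ {n} (f : Fin n → Fin n → ℕ) →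
  ∑ (λ u → ∑ (f u)) + ∑ (λ u → ∑ (f u)) ≡ ∑ (λ u → ∑ (λ v → f u v + f v u))
∑∑-double f = begin
  ∑ (λ u → ∑ (f u)) + ∑ (λ u → ∑ (f u))                   ≡⟨ cong (∑ (λ u → ∑ (f u)) +_) (∑-comm f) ⟩
  ∑ (λ u → ∑ (f u)) + ∑ (λ u → ∑ (λ v → f v u))           ≡⟨ ∑-distrib-+ (λ u → ∑ (f u)) _ ⟨
  ∑ (λ u → ∑ (f u) + ∑ (λ v → f v u))                     ≡⟨ ∑-cong (λ u → ∑-distrib-+ (f u) (λ v → f v u)) ⟨
  ∑ (λ u → ∑ (λ v → f u v + f v u))                       ∎
  where open ≡-Reasoning

∣≔true∣ : ∀ {n} (C : Subset n) u → lookup C u ≡ false → ∣ C [ u ]≔ true ∣ ≡ suc ∣ C ∣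
∣≔true∣ C u Cu = begin
  ∣ C [ u ]≔ true ∣                ≡⟨ ∣∣≡count (C [ u ]≔ true) ⟩
  count (lookup (C [ u ]≔ true))  ≡⟨ ∑-bump _ _ u at-u elsewhere ⟩
  suc (count (lookup C))          ≡⟨ cong suc (sym (∣∣≡count C)) ⟩
  suc ∣ C ∣                        ∎
  where
  open ≡-Reasoning
  at-u : 𝟙 (lookup (C [ u ]≔ true) u) ≡ 1 + 𝟙 (lookup C u)
  at-u rewrite lookup∘update u C true | Cu = refl
  elsewhere : ∀ j → j ≢ u → 𝟙 (lookup (C [ u ]≔ true) j) ≡ 𝟙 (lookup C j)
  elsewhere j j≢u = cong 𝟙 (lookup∘update′ j≢u C true)

count-const : ∀ {n} (p : Fin n → Bool) → (∀ v → p v ≡ true) → count p ≡ n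
count-const {zero}  p all = refl
count-const {suc n} p all rewrite all zero = cong suc (count-const (p ∘ suc) (all ∘ suc))

∣∣≡n : ∀ {n} (C : Subset n) → (∀ v → lookup C v ≡ true) → ∣ C ∣ ≡ n
∣∣≡n C all = trans (∣∣≡count C) (count-const (lookup C) all)

count-not+count : ∀ {n} (p : Fin n → Bool) → count (not ∘ p) + count p ≡ n
count-not+count {n} p = begin
  count (not ∘ p) + count p          ≡⟨ sym (∑-distrib-+ (𝟙 ∘ not ∘ p) (𝟙 ∘ p)) ⟩
  ∑ (λ v → 𝟙 (not (p v)) + 𝟙 (p v))  ≡⟨ ∑-cong (λ v → one (p v)) ⟩
  count {n} (λ _ → true)             ≡⟨ count-const (λ _ → true) (λ _ → refl) ⟩
  n                                  ∎
  where
  open ≡-Reasoning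
  one : ∀ b → 𝟙 (not b) + 𝟙 b ≡ 1
  one true  = refl
  one false = refl

∣_∣ᶜ : ∀ {n} → Subset n → ℕ
∣ C ∣ᶜ = count (not ∘ lookup C)

∣≔true∣ᶜ : ∀ {n} (C : Subset n) u → lookup C u ≡ false → ∣ C ∣ᶜ ≡ suc ∣ C [ u ]≔ true ∣ᶜ
∣≔true∣ᶜ C u Cu = ∑-bump _ _ u at-u elsewhere
  where
  at-u : 𝟙 (not (lookup C u)) ≡ 1 + 𝟙 (not (lookup (C [ u ]≔ true) u))
  at-u rewrite lookup∘update u C true | Cu = refl
  elsewhere : ∀ j → j ≢ u → 𝟙 (not (lookup C j)) ≡ 𝟙 (not (lookup (C [ u ]≔ true) j))
  elsewhere j j≢u = cong (𝟙 ∘ not) (sym (lookup∘update′ j≢u C true))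

toSubset : ∀ {n} → List (Fin n) → Subset n
toSubset []       = ∅
toSubset (u ∷ us) = toSubset us [ u ]≔ true

∈⇒toSubset : ∀ {n} {v : Fin n} {us} → v ∈ us → lookup (toSubset us) v ≡ true
∈⇒toSubset {us = u ∷ us} (here refl) = lookup∘update u (toSubset us) true
∈⇒toSubset {us = u ∷ us} (there v∈us) = ≔true-mono (toSubset us) u (∈⇒toSubset v∈us)

toSubset⇒∈ : ∀ {n} {v : Fin n} us → lookup (toSubset us) v ≡ true → v ∈ us
toSubset⇒∈ {v = v} [] e = ⊥-elim (true≢false (trans (sym e) (lookup-replicate v false)))
toSubset⇒∈ {v = v} (u ∷ us) e with u ≟ v
... | yes refl = here refl
... | no u≢v   = there (toSubset⇒∈ us (trans (sym (lookup∘update′ (≢-sym u≢v) (toSubset us) true)) e))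

<ᵇ-exclusive : ∀ m n → m ≢ n → 𝟙 (m <ᵇ n) + 𝟙 (n <ᵇ m) ≡ 1
<ᵇ-exclusive zero    zero    m≢n = ⊥-elim (m≢n refl)
<ᵇ-exclusive zero    (suc n) _   = refl
<ᵇ-exclusive (suc m) zero    _   = refl
<ᵇ-exclusive (suc m) (suc n) m≢n = <ᵇ-exclusive m n (m≢n ∘ cong suc)

+-self-injective : ∀ a b → a + a ≡ b + b → a ≡ b
+-self-injective a b e = *-cancelˡ-≡ a b 2 (begin
  2 * a  ≡⟨ cong (a +_) (+-identityʳ a) ⟩
  a + a  ≡⟨ e ⟩
  b + b  ≡⟨ cong (b +_) (+-identityʳ b) ⟨
  2 * b  ∎)
  where open ≡-Reasoning

≤-from-budget : ∀ {k n s ℓ} → k ≤ n → n ≤ s + ℓ → ℓ ≤ n ∸ k → k ≤ s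
≤-from-budget {k} {n} {s} {ℓ} k≤n n≤s+ℓ ℓ≤n∸k = +-cancelʳ-≤ ℓ k s (begin
  k + ℓ        ≤⟨ +-monoʳ-≤ k ℓ≤n∸k ⟩
  k + (n ∸ k)  ≡⟨ m+[n∸m]≡n k≤n ⟩
  n            ≤⟨ n≤s+ℓ ⟩
  s + ℓ        ∎)
  where open ≤-Reasoning

minimal : ∀ {P : ℕ → Set} → Decidable P → ∀ {b} → P b → Σ ℕ λ k → P k × (∀ j → P j → k ≤ j)
minimal {P} P? {b} pb with ¬∀⟶∃¬-smallest (suc b) (¬_ ∘ P ∘ toℕ) (¬? ∘ P? ∘ toℕ)
                                         (λ none → none (fromℕ b) (subst P (sym (toℕ-fromℕ b)) pb))
... | i , ¬¬pi , below = toℕ i , decidable-stable (P? (toℕ i)) ¬¬pi , least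
  where
  least : ∀ j → P j → toℕ i ≤ j
  least j pj = ≮⇒≥ λ j<i →
    below (fromℕ< j<i) (subst P (sym (trans (toℕ-inject (fromℕ< j<i)) (toℕ-fromℕ< j<i))) pj)

fold-shift : ∀ {A : Set} (f : A → A) z k → fold (f z) f k ≡ f (fold z f k)
fold-shift f z zero    = refl
fold-shift f z (suc k) = cong f (fold-shift f z k)

module Orbit {A : Set} (f : A → A) (c : A) (r : ℕ) (periodic : fold c f (suc r) ≡ c) where

  InOrbit : A → Set
  InOrbit v = ∃ λ k → fold c f k ≡ v

  fold-period-multiple : ∀ m → fold c f (m * suc r) ≡ c
  fold-period-multiple zero    = refl
  fold-period-multiple (suc m) = begin
    fold c f (suc r + m * suc r)           ≡⟨ fold-+ c f (suc r) ⟩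
    fold (fold c f (m * suc r)) f (suc r)  ≡⟨ cong (λ x → fold x f (suc r)) (fold-period-multiple m) ⟩
    fold c f (suc r)                       ≡⟨ periodic ⟩
    c                                      ∎
    where open ≡-Reasoning

  fold-mod : ∀ k → fold c f (k % suc r) ≡ fold c f k
  fold-mod k = begin
    fold c f (k % suc r)                                 ≡⟨ cong (λ x → fold x f (k % suc r)) (fold-period-multiple q) ⟨
    fold (fold c f (q * suc r)) f (k % suc r)            ≡⟨ fold-+ c f (k % suc r) ⟨
    fold c f (k % suc r + q * suc r)                     ≡⟨ cong (fold c f) (m≡m%n+[m/n]*n k (suc r)) ⟨
    fold c f k                                           ∎
    where
    open ≡-Reasoning
    q : ℕ
    q = k / suc r

  inOrbit? : DecidableEquality A → Decidable InOrbit
  inOrbit? _≟ᴬ_ v with any? (λ (k : Fin (suc r)) → fold c f (toℕ k) ≟ᴬ v)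
  ... | yes (k , e) = yes (toℕ k , e)
  ... | no ¬k = no λ (k , e) → ¬k (fromℕ< (m%n<n k (suc r)) ,
                                   trans (cong (fold c f) (toℕ-fromℕ< (m%n<n k (suc r)))) (trans (fold-mod k) e))

  back : A → A
  back v = fold v f r

  f∘back : ∀ {v} → InOrbit v → f (back v) ≡ v
  f∘back (k , refl) = begin
    fold (fold c f k) f (suc r)  ≡⟨ fold-+ c f (suc r) ⟨
    fold c f (suc r + k)         ≡⟨ cong (fold c f) (+-comm (suc r) k) ⟩
    fold c f (k + suc r)         ≡⟨ fold-+ c f k ⟩
    fold (fold c f (suc r)) f k  ≡⟨ cong (λ x → fold x f k) periodic ⟩
    fold c f k                   ∎
    where open ≡-Reasoning

  f-closed : ∀ {v} → InOrbit v → InOrbit (f v)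
  f-closed (k , refl) = suc k , refl

  back-closed : ∀ {v} → InOrbit v → InOrbit (back v)
  back-closed (k , refl) = r + k , fold-+ c f r

  back∘f : ∀ {v} → InOrbit v → back (f v) ≡ v
  back∘f {v} o = trans (fold-shift f v r) (f∘back o)

choice : ∀ {n} {P : Fin n → Set} {Q : Fin n → Fin n → Set} → Decidable P →
         (∀ v → P v → ∃ (Q v)) → Σ (Fin n → Fin n) λ g → ∀ v → P v → Q v (g v)
choice {n} {P} {Q} P? h = g , g-spec
  where
  g : Fin n → Fin n
  g v with P? v
  ... | yes p = proj₁ (h v p)
  ... | no _  = v
  g-spec : ∀ v → P v → Q v (g v)
  g-spec v p with P? v
  ... | yes p′ = proj₂ (h v p′)
  ... | no ¬p  = ⊥-elim (¬p p)

periodic-point : ∀ {n} (f : Fin n → Fin n) x → ∃₂ λ i r → fold (fold x f i) f (suc r) ≡ fold x f i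
periodic-point {n} f x with pigeonhole (n<1+n n) (λ (k : Fin (suc n)) → fold x f (toℕ k))
... | i , j , i<j , same = toℕ i , toℕ j ∸ suc (toℕ i) , (begin
  fold (fold x f (toℕ i)) f (suc (toℕ j ∸ suc (toℕ i)))  ≡⟨ cong (fold (fold x f (toℕ i)) f) (+-∸-assoc 1 i<j) ⟨
  fold (fold x f (toℕ i)) f (toℕ j ∸ toℕ i)              ≡⟨ fold-+ x f (toℕ j ∸ toℕ i) ⟨
  fold x f (toℕ j ∸ toℕ i + toℕ i)                       ≡⟨ cong (fold x f) (m∸n+n≡m (<⇒≤ i<j)) ⟩
  fold x f (toℕ j)                                       ≡⟨ same ⟨
  fold x f (toℕ i)                                       ∎)
  where open ≡-Reasoning

module _ {n : ℕ} (G : Graph n) where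

  bipEdges⇒ : ∀ V₁ V₂ {a b} → bipEdges G V₁ V₂ a b ≡ true → adj G a b ≡ true ×
    ((lookup V₁ a ≡ true × lookup V₂ b ≡ true) ⊎ (lookup V₂ a ≡ true × lookup V₁ b ≡ true))
  bipEdges⇒ V₁ V₂ e with ∧-true e
  ... | a , sides with ∨-true sides
  ...   | inj₁ s = a , inj₁ (∧-true s)
  ...   | inj₂ s = a , inj₂ (∧-true s)

  ⇒bipEdges₁₂ : ∀ V₁ V₂ {a b} → adj G a b ≡ true → lookup V₁ a ≡ true → lookup V₂ b ≡ true →
                bipEdges G V₁ V₂ a b ≡ true
  ⇒bipEdges₁₂ V₁ V₂ ab V₁a V₂b rewrite ab | V₁a | V₂b = refl

  ⇒bipEdges₂₁ : ∀ V₁ V₂ {a b} → adj G a b ≡ true → lookup V₂ a ≡ true → lookup V₁ b ≡ true →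
                bipEdges G V₁ V₂ a b ≡ true
  ⇒bipEdges₂₁ V₁ V₂ {a} ab V₂a V₁b rewrite ab | V₂a | V₁b = ∨-zeroʳ (lookup V₁ a ∧ _)

  Precedes : Fin n × Fin n → Fin n × Fin n → Set
  Precedes (c , u) (c′ , u′) = adj G c u′ ≡ false × u′ ≢ c × c′ ≢ u

  data Triangular : List (Fin n × Fin n) → Set where
    []   : Triangular []
    cons : ∀ {c u ps} → adj G c u ≡ true → All (Precedes (c , u)) ps → Triangular ps →
           Triangular ((c , u) ∷ ps)

  adj-true-false : ∀ {c u c′ u′} → adj G c u ≡ true → adj G c′ u′ ≡ false → c ≡ c′ → u ≢ u′
  adj-true-false a b refl refl = true≢false (trans (sym a) b)

  triangular-adj : ∀ {ps c u} → Triangular ps → (c , u) ∈ ps → adj G c u ≡ true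
  triangular-adj (cons a _ _)  (here refl) = a
  triangular-adj (cons _ _ t) (there m)   = triangular-adj t m

  forcer-determines-forced : ∀ {ps c u u′} → Triangular ps → (c , u) ∈ ps → (c , u′) ∈ ps → u ≡ u′
  forcer-determines-forced t             (here refl) (here refl) = refl
  forcer-determines-forced t@(cons a p _) (here refl) (there m′) =
    ⊥-elim (adj-true-false (triangular-adj t (there m′)) (proj₁ (All.lookup p m′)) refl refl)
  forcer-determines-forced t@(cons a p _) (there m)  (here refl) =
    ⊥-elim (adj-true-false (triangular-adj t (there m)) (proj₁ (All.lookup p m)) refl refl)
  forcer-determines-forced (cons _ _ t)  (there m)  (there m′) = forcer-determines-forced t m m′

  forced-determines-forcer : ∀ {ps c c′ u} → Triangular ps → (c , u) ∈ ps → (c′ , u) ∈ ps → c ≡ c′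
  forced-determines-forcer t             (here refl) (here refl) = refl
  forced-determines-forcer (cons a p _)  (here refl) (there m′) = ⊥-elim (adj-true-false a (proj₁ (All.lookup p m′)) refl refl)
  forced-determines-forcer (cons a p _)  (there m)  (here refl) = ⊥-elim (adj-true-false a (proj₁ (All.lookup p m)) refl refl)
  forced-determines-forcer (cons _ _ t)  (there m)  (there m′) = forced-determines-forcer t m m′

  forcer≢forced : ∀ {ps c u c′ u′} → Triangular ps → (c , u) ∈ ps → (c′ , u′) ∈ ps → c ≢ u′
  forcer≢forced (cons a _ _) (here refl) (here refl) refl = true≢false (trans (sym a) (irrefl G _))
  forcer≢forced (cons _ p _) (here refl) (there m′) e = proj₁ (proj₂ (All.lookup p m′)) (sym e)
  forcer≢forced (cons _ p _) (there m)  (here refl) e = proj₂ (proj₂ (All.lookup p m)) e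
  forcer≢forced (cons _ _ t) (there m)  (there m′) e = forcer≢forced t m m′ e

  Joins : Fin n → Fin n → Fin n × Fin n → Set
  Joins a b (c , u) = (a ≡ c × b ≡ u) ⊎ (a ≡ u × b ≡ c)

  joins? : ∀ a b q → Dec (Joins a b q)
  joins? a b (c , u) = ((a ≟ c) ×-dec (b ≟ u)) ⊎-dec ((a ≟ u) ×-dec (b ≟ c))

  matchingOf : List (Fin n × Fin n) → EdgeSet G
  matchingOf ps a b = does (Any.any? (joins? a b) ps)

  matchingOf⇒ : ∀ {ps a b} → matchingOf ps a b ≡ true → ∃ λ q → q ∈ ps × Joins a b q
  matchingOf⇒ {ps} {a} {b} e = find (does-true (Any.any? (joins? a b) ps) e)

  ∈⇒matchingOf : ∀ {ps c u} → (c , u) ∈ ps → matchingOf ps c u ≡ true × matchingOf ps u c ≡ true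
  ∈⇒matchingOf {ps} {c} {u} m =
    dec-true (Any.any? (joins? c u) ps) (lose m (inj₁ (refl , refl))) ,
    dec-true (Any.any? (joins? u c) ps) (lose m (inj₂ (refl , refl)))

  forcers forced : List (Fin n × Fin n) → Subset n
  forcers ps = toSubset (map proj₁ ps)
  forced  ps = toSubset (map proj₂ ps)

  ∈⇒forcer : ∀ {ps c u} → (c , u) ∈ ps → lookup (forcers ps) c ≡ true
  ∈⇒forcer m = ∈⇒toSubset (∈-map⁺ proj₁ m)

  ∈⇒forced : ∀ {ps c u} → (c , u) ∈ ps → lookup (forced ps) u ≡ true
  ∈⇒forced m = ∈⇒toSubset (∈-map⁺ proj₂ m)

  forcer⇒∈ : ∀ {ps v} → lookup (forcers ps) v ≡ true → ∃ λ u → (v , u) ∈ ps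
  forcer⇒∈ {ps} e with ∈-map⁻ proj₁ (toSubset⇒∈ (map proj₁ ps) e)
  ... | (c , u) , m , refl = u , m

  forced⇒∈ : ∀ {ps v} → lookup (forced ps) v ≡ true → ∃ λ c → (c , v) ∈ ps
  forced⇒∈ {ps} e with ∈-map⁻ proj₂ (toSubset⇒∈ (map proj₂ ps) e)
  ... | (c , u) , m , refl = c , m

  contains-triangular : ∀ {M ps} → IsMatchingIn G (adj G) M → Triangular ps →
    (∀ {c} → lookup (forcers ps) c ≡ true → ∃ λ w → M c w ≡ true) →
    (∀ {c w} → lookup (forcers ps) c ≡ true → M c w ≡ true → lookup (forced ps) w ≡ true) →
    All (λ (c , u) → M c u ≡ true) ps
  contains-triangular _ [] _ _ = []
  contains-triangular {M} {(c , u) ∷ ps} m@(M-sym , M-adj , M-fun) t@(cons cu p tail) covers into =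
    Mcu ∷ contains-triangular m tail (covers ∘ forcers-tail) into-tail
    where
    forcers-tail : ∀ {v} → lookup (forcers ps) v ≡ true → lookup (forcers ((c , u) ∷ ps)) v ≡ true
    forcers-tail = ≔true-mono (forcers ps) c
    c-forcer : lookup (forcers ((c , u) ∷ ps)) c ≡ true
    c-forcer = ∈⇒forcer {(c , u) ∷ ps} (here refl)
    Mcu : M c u ≡ true
    Mcu with covers c-forcer
    ... | w , Mcw with forced⇒∈ {(c , u) ∷ ps} (into c-forcer Mcw)
    ...   | _ , here refl = Mcw
    ...   | _ , there m′  = ⊥-elim (adj-true-false (M-adj c w Mcw) (proj₁ (All.lookup p m′)) refl refl)
    into-tail : ∀ {c′ w} → lookup (forcers ps) c′ ≡ true → M c′ w ≡ true → lookup (forced ps) w ≡ true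
    into-tail {c′} {w} c′-forcer Mc′w with ≔true⇒ (forced ps) u (into (forcers-tail c′-forcer) Mc′w)
    ... | inj₂ w-forced = w-forced
    ... | inj₁ refl with forcer⇒∈ {ps} c′-forcer
    ...   | u′ , m′ = ⊥-elim (adj-true-false (triangular-adj t (there m′)) (proj₁ (All.lookup p m′)) c′≡c refl)
      where
      c′≡c : c′ ≡ c
      c′≡c = M-fun u c′ c (trans (M-sym u c′) Mc′w) (trans (M-sym u c) Mcu)

  joins-sym : ∀ {a b q} → Joins a b q → Joins b a q
  joins-sym (inj₁ (refl , refl)) = inj₂ (refl , refl)
  joins-sym (inj₂ (refl , refl)) = inj₁ (refl , refl)

  matchingOf-sym : ∀ ps a b → matchingOf ps a b ≡ matchingOf ps b a
  matchingOf-sym ps a b = true-≡ (flip a b) (flip b a)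
    where
    flip : ∀ a b → matchingOf ps a b ≡ true → matchingOf ps b a ≡ true
    flip a b e with matchingOf⇒ {ps} e
    ... | q , m , j = dec-true (Any.any? (joins? b a) ps) (lose m (joins-sym j))

  matchingOf-adj : ∀ {ps} → Triangular ps → ∀ a b → matchingOf ps a b ≡ true → adj G a b ≡ true
  matchingOf-adj {ps} t a b e with matchingOf⇒ {ps} e
  ... | _ , m , inj₁ (refl , refl) = triangular-adj t m
  ... | _ , m , inj₂ (refl , refl) = trans (adj-sym G a b) (triangular-adj t m)

  matchingOf-functional : ∀ {ps} → Triangular ps → ∀ a v w →
    matchingOf ps a v ≡ true → matchingOf ps a w ≡ true → v ≡ w
  matchingOf-functional {ps} t a v w e e′ with matchingOf⇒ {ps} e | matchingOf⇒ {ps} e′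
  ... | _ , m , inj₁ (refl , refl) | _ , m′ , inj₁ (refl , refl) = forcer-determines-forced t m m′
  ... | _ , m , inj₁ (refl , refl) | _ , m′ , inj₂ (refl , refl) = ⊥-elim (forcer≢forced t m m′ refl)
  ... | _ , m , inj₂ (refl , refl) | _ , m′ , inj₁ (refl , refl) = ⊥-elim (forcer≢forced t m′ m refl)
  ... | _ , m , inj₂ (refl , refl) | _ , m′ , inj₂ (refl , refl) = forced-determines-forcer t m m′

  matchingOf-bipartite : ∀ {ps} → Triangular ps → ∀ a b → matchingOf ps a b ≡ true →
    bipEdges G (forcers ps) (forced ps) a b ≡ true
  matchingOf-bipartite {ps} t a b e with matchingOf⇒ {ps} e
  ... | _ , m , inj₁ (refl , refl) = ⇒bipEdges₁₂ (forcers ps) (forced ps) (matchingOf-adj t a b e) (∈⇒forcer m) (∈⇒forced m)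
  ... | _ , m , inj₂ (refl , refl) = ⇒bipEdges₂₁ (forcers ps) (forced ps) (matchingOf-adj t a b e) (∈⇒forced m) (∈⇒forcer m)

  forcers-disjoint-forced : ∀ {ps} → Triangular ps →
    ∀ v → lookup (forcers ps) v ≡ true → lookup (forced ps) v ≡ false
  forcers-disjoint-forced {ps} t v e with forcer⇒∈ {ps} e
  ... | u , m = ¬-not λ e′ → forcer≢forced t m (proj₂ (forced⇒∈ {ps} e′)) refl

  matchingOf-perfect : ∀ {ps} → Triangular ps → IsPerfectMatching G (forcers ps) (forced ps) (matchingOf ps)
  matchingOf-perfect {ps} t = (matchingOf-sym ps , matchingOf-bipartite t , matchingOf-functional t) , covers
    where
    covers : ∀ v → (lookup (forcers ps) v ∨ lookup (forced ps) v) ≡ true → ∃ λ w → matchingOf ps v w ≡ true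
    covers v e with ∨-true e
    ... | inj₁ e₁ = let u , m = forcer⇒∈ {ps} e₁ in u , proj₁ (∈⇒matchingOf m)
    ... | inj₂ e₂ = let c , m = forced⇒∈ {ps} e₂ in c , proj₂ (∈⇒matchingOf m)

  triangular-unique : ∀ {ps} → Triangular ps → ∀ M → IsPerfectMatching G (forcers ps) (forced ps) M →
                      ∀ a b → M a b ≡ matchingOf ps a b
  triangular-unique {ps} t M ((M-sym , M-bip , M-fun) , M-covers) a b = true-≡ ⇒matching matching⇒
    where
    into : ∀ {c w} → lookup (forcers ps) c ≡ true → M c w ≡ true → lookup (forced ps) w ≡ true
    into {c} c-forcer Mcw with proj₂ (bipEdges⇒ (forcers ps) (forced ps) (M-bip c _ Mcw))
    ... | inj₁ (_ , w-forced) = w-forced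
    ... | inj₂ (c-forced , _) = ⊥-elim (true≢false (trans (sym c-forced) (forcers-disjoint-forced t c c-forcer)))
    contains : All (λ (c , u) → M c u ≡ true) ps
    contains = contains-triangular (M-sym , (λ a b → proj₁ ∘ bipEdges⇒ (forcers ps) (forced ps) ∘ M-bip a b) , M-fun) t
                                   (λ {c} e → M-covers c (cong (_∨ lookup (forced ps) c) e)) into
    ⇒matching : M a b ≡ true → matchingOf ps a b ≡ true
    ⇒matching e with proj₂ (bipEdges⇒ (forcers ps) (forced ps) (M-bip a b e))
    ... | inj₁ (a-forcer , _) = let u , m = forcer⇒∈ {ps} a-forcer in
      subst (λ x → matchingOf ps a x ≡ true) (M-fun a u b (All.lookup contains m) e) (proj₁ (∈⇒matchingOf m))
    ... | inj₂ (a-forced , _) = let c , m = forced⇒∈ {ps} a-forced in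
      subst (λ x → matchingOf ps a x ≡ true) (M-fun a c b (trans (M-sym a c) (All.lookup contains m)) e)
            (proj₂ (∈⇒matchingOf m))
    matching⇒ : matchingOf ps a b ≡ true → M a b ≡ true
    matching⇒ e with matchingOf⇒ {ps} e
    ... | _ , m , inj₁ (refl , refl) = All.lookup contains m
    ... | _ , m , inj₂ (refl , refl) = trans (M-sym a b) (All.lookup contains m)

  triangular-uniqueness : ∀ {ps} → Triangular ps → HasUniqueness G (matchingOf ps)
  triangular-uniqueness {ps} t =
    (matchingOf-sym ps , matchingOf-adj t , matchingOf-functional t) ,
    forcers ps , forced ps , forcers-disjoint-forced t , matchingOf-perfect t , triangular-unique t

  ∣forced∣≡length : ∀ {ps} → Triangular ps → ∣ forced ps ∣ ≡ length ps
  ∣forced∣≡length [] = ∣⊥∣≡0 n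
  ∣forced∣≡length {(c , u) ∷ ps} (cons cu p t) =
    trans (∣≔true∣ (forced ps) u u-fresh) (cong suc (∣forced∣≡length t))
    where
    u-fresh : lookup (forced ps) u ≡ false
    u-fresh = ¬-not λ e → let _ , m = forced⇒∈ {ps} e in
      adj-true-false cu (proj₁ (All.lookup p m)) refl refl

module _ {n : ℕ} (G : Graph n) where

  esize≡∑count : ∀ M → esize G M ≡ ∑ (λ u → count (λ v → M u v ∧ (toℕ u <ᵇ toℕ v)))
  esize≡∑count M = trans (sum-tabulate (λ u → ∣ tabulate (later u) ∣)) (∑-cong (∣tabulate∣≡count ∘ later))
    where
    later : Fin n → Fin n → Bool
    later u v = M u v ∧ (toℕ u <ᵇ toℕ v)

  -- Double counting: each edge of M has exactly one end in V₂.
  esize-perfect : ∀ {V₁ V₂ M} → (∀ v → lookup V₁ v ≡ true → lookup V₂ v ≡ false) →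
                  IsPerfectMatching G V₁ V₂ M → esize G M ≡ ∣ V₂ ∣
  esize-perfect {V₁} {V₂} {M} disjoint ((M-sym , M-bip , M-fun) , M-covers) =
    +-self-injective _ _ (begin
      esize G M + esize G M                     ≡⟨ cong₂ _+_ (esize≡∑count M) (esize≡∑count M) ⟩
      ∑ (λ u → ∑ (T u)) + ∑ (λ u → ∑ (T u))     ≡⟨ ∑∑-double T ⟩
      ∑ (λ u → ∑ (λ v → T u v + T v u))         ≡⟨ ∑-cong (λ u → ∑-cong (T≡B u)) ⟩
      ∑ (λ u → ∑ (λ v → B u v + B v u))         ≡⟨ ∑∑-double B ⟨
      ∑ (λ u → ∑ (B u)) + ∑ (λ u → ∑ (B u))     ≡⟨ cong₂ _+_ ∑∑B ∑∑B ⟩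
      ∣ V₂ ∣ + ∣ V₂ ∣                           ∎)
    where
    open ≡-Reasoning
    T B : Fin n → Fin n → ℕ
    T u v = 𝟙 (M u v ∧ (toℕ u <ᵇ toℕ v))
    B u v = 𝟙 (M u v ∧ lookup V₂ v)

    one-side-in-V₂ : ∀ u v → M u v ≡ true → 𝟙 (lookup V₂ v) + 𝟙 (lookup V₂ u) ≡ 1
    one-side-in-V₂ u v e with proj₂ (bipEdges⇒ G V₁ V₂ (M-bip u v e))
    ... | inj₁ (V₁u , V₂v) rewrite V₂v | disjoint u V₁u = refl
    ... | inj₂ (V₂u , V₁v) rewrite V₂u | disjoint v V₁v = refl

    T≡B : ∀ u v → T u v + T v u ≡ B u v + B v u
    T≡B u v with M u v in e
    ... | false rewrite trans (M-sym v u) e = refl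
    ... | true  rewrite trans (M-sym v u) e =
      trans (<ᵇ-exclusive (toℕ u) (toℕ v) (u≢v ∘ toℕ-injective)) (sym (one-side-in-V₂ u v e))
      where
      u≢v : u ≢ v
      u≢v refl = true≢false (trans (sym (proj₁ (bipEdges⇒ G V₁ V₂ (M-bip u u e)))) (irrefl G u))

    column : ∀ v → ∑ (λ u → B u v) ≡ 𝟙 (lookup V₂ v)
    column v with lookup V₂ v in V₂v
    ... | false = trans (∑-cong (λ u → cong 𝟙 (∧-zeroʳ (M u v)))) (sum-replicate-zero n)
    ... | true with M-covers v (trans (cong (lookup V₁ v ∨_) V₂v) (∨-zeroʳ _))
    ...   | w , Mvw = trans (∑-single (λ u → 𝟙 (M u v ∧ true)) w only-w)
                            (cong (λ x → 𝟙 (x ∧ true)) (trans (M-sym w v) Mvw))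
      where
      only-w : ∀ u → u ≢ w → 𝟙 (M u v ∧ true) ≡ 0
      only-w u u≢w with M u v in Muv
      ... | false = refl
      ... | true  = ⊥-elim (u≢w (M-fun v u w (trans (M-sym v u) Muv) Mvw))

    ∑∑B : ∑ (λ u → ∑ (B u)) ≡ ∣ V₂ ∣
    ∑∑B = begin
      ∑ (λ u → ∑ (B u))          ≡⟨ ∑-comm B ⟩
      ∑ (λ v → ∑ (λ u → B u v))  ≡⟨ ∑-cong column ⟩
      count (lookup V₂)          ≡⟨ ∣∣≡count V₂ ⟨
      ∣ V₂ ∣                     ∎

  esize-triangular : ∀ {ps} → Triangular G ps → esize G (matchingOf G ps) ≡ length ps
  esize-triangular {ps} t =
    trans (esize-perfect {forcers G ps} {forced G ps} (forcers-disjoint-forced G t) (matchingOf-perfect G t))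
          (∣forced∣≡length G t)

module _ {n : ℕ} (G : Graph n) where

  Saturated : Subset n → Fin n → Fin n → Set
  Saturated C c u = ∀ w → adj G c w ≡ true → w ≢ u → lookup C w ≡ true

  saturated-at? : ∀ C c u w → Dec (adj G c w ≡ true → w ≢ u → lookup C w ≡ true)
  saturated-at? C c u w = (adj G c w Bool.≟ true) →-dec ¬? (w ≟ u) →-dec (lookup C w Bool.≟ true)

  saturated? : ∀ C c u → Dec (Saturated C c u)
  saturated? C c u = all? (saturated-at? C c u)

  unsaturated⇒ : ∀ C c u → ¬ Saturated C c u → ∃ λ w → adj G c w ≡ true × w ≢ u × lookup C w ≡ false
  unsaturated⇒ C c u ¬saturated with ¬∀⟶∃¬ n _ (saturated-at? C c u) ¬saturated
  ... | w , ¬saturated-w with adj G c w in cw | w ≟ u | lookup C w in Cw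
  ...   | false | _        | _     = ⊥-elim (¬saturated-w λ ())
  ...   | true  | yes refl | _     = ⊥-elim (¬saturated-w λ _ w≢w → ⊥-elim (w≢w refl))
  ...   | true  | no _     | true  = ⊥-elim (¬saturated-w λ _ _ → refl)
  ...   | true  | no w≢u   | false = w , cw , w≢u , Cw

  LegalForce : Subset n → Subset n → Fin n → Fin n → Set
  LegalForce S C c u = lookup S c ≡ true × lookup C c ≡ true × lookup C u ≡ false × adj G c u ≡ true × Saturated C c u

  zfRun-by-strategy : ∀ {S} (Good : Subset n → Set) →
    (∀ C → Good C → (∀ v → lookup C v ≡ true) ⊎ ∃₂ λ c u → LegalForce S C c u × Good (C [ u ]≔ true)) →
    ∀ C → Good C → ZFRun G S C
  zfRun-by-strategy {S} Good advance C good = run ∣ C ∣ᶜ refl good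
    where
    run : ∀ k {C} → ∣ C ∣ᶜ ≡ k → Good C → ZFRun G S C
    run k {C} _ good with advance C good
    ... | inj₁ all = done all
    run zero    {C} e _ | inj₂ (c , u , (_ , _ , Cu , _) , _) = ⊥-elim (0≢1+n (trans (sym e) (∣≔true∣ᶜ C u Cu)))
    run (suc k) {C} e _ | inj₂ (c , u , (Sc , Cc , Cu , cu , others) , good′) =
      force c u Sc Cc Cu cu others (run k (suc-injective (trans (sym (∣≔true∣ᶜ C u Cu)) e)) good′)

  legalForce? : ∀ S C c u → Dec (LegalForce S C c u)
  legalForce? S C c u = (lookup S c Bool.≟ true) ×-dec (lookup C c Bool.≟ true) ×-dec (lookup C u Bool.≟ false) ×-dec
    (adj G c u Bool.≟ true) ×-dec saturated? C c u

  zfRun? : ∀ S C → Dec (ZFRun G S C)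
  zfRun? S C = decide ∣ C ∣ᶜ C refl
    where
    decide : ∀ k C → ∣ C ∣ᶜ ≡ k → Dec (ZFRun G S C)
    decide k C e with all? (λ v → lookup C v Bool.≟ true)
    ... | yes all = yes (done all)
    decide zero C e | no ¬all = no λ
      { (done all) → ¬all all
      ; (force c u _ _ Cu _ _ _) → 0≢1+n (trans (sym e) (∣≔true∣ᶜ C u Cu))
      }
    decide (suc k) C e | no ¬all with any? (λ c → any? (λ u → step? c u))
      where
      step? : ∀ c u → Dec (LegalForce S C c u × ZFRun G S (C [ u ]≔ true))
      step? c u with legalForce? S C c u
      ... | no ¬legal = no (¬legal ∘ proj₁)
      ... | yes legal@(_ , _ , Cu , _) with decide k (C [ u ]≔ true) (suc-injective (trans (sym (∣≔true∣ᶜ C u Cu)) e))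
      ...   | yes run = yes (legal , run)
      ...   | no ¬run = no (¬run ∘ proj₂)
    ... | yes (c , u , (Sc , Cc , Cu , cu , others) , run) = yes (force c u Sc Cc Cu cu others run)
    ... | no ¬step = no λ
      { (done all) → ¬all all
      ; (force c u Sc Cc Cu cu others run) → ¬step (c , u , (Sc , Cc , Cu , cu , others) , run)
      }

  czf-attained : Σ ℕ (IsCZF G)
  czf-attained with minimal {λ k → Σ (Subset n) λ S → IsCZFSet G S × ∣ S ∣ ≡ k}
                            (λ k → anySubset? (λ S → zfRun? S S ×-dec (∣ S ∣ ℕ.≟ k)))
                            (⊤ , done (λ v → lookup-replicate v true) , ∣⊤∣≡n n)
  ... | k , witness , least = k , witness , λ S zf → least ∣ S ∣ (S , zf , refl)

module UniquelyMatched {n : ℕ} (G : Graph n) {M : EdgeSet G} {V₁ V₂ : Subset n}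
  (disjoint : ∀ v → lookup V₁ v ≡ true → lookup V₂ v ≡ false)
  (perfect  : IsPerfectMatching G V₁ V₂ M)
  (unique   : ∀ M′ → IsPerfectMatching G V₁ V₂ M′ → ∀ u v → M′ u v ≡ M u v) where

  private
    M-sym : ∀ a b → M a b ≡ M b a
    M-sym = proj₁ (proj₁ perfect)
    M-bip : ∀ a b → M a b ≡ true → bipEdges G V₁ V₂ a b ≡ true
    M-bip = proj₁ (proj₂ (proj₁ perfect))
    M-fun : ∀ a v w → M a v ≡ true → M a w ≡ true → v ≡ w
    M-fun = proj₂ (proj₂ (proj₁ perfect))
    M-covers : ∀ v → (lookup V₁ v ∨ lookup V₂ v) ≡ true → ∃ λ w → M v w ≡ true
    M-covers = proj₂ perfect

  Covered : Fin n → Set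
  Covered v = (lookup V₁ v ∨ lookup V₂ v) ≡ true

  V₁⇒Covered : ∀ {v} → lookup V₁ v ≡ true → Covered v
  V₁⇒Covered e rewrite e = refl

  V₂⇒Covered : ∀ {v} → lookup V₂ v ≡ true → Covered v
  V₂⇒Covered {v} e rewrite e = ∨-zeroʳ (lookup V₁ v)

  partner : Fin n → Fin n
  partner v with any? (λ w → M v w Bool.≟ true)
  ... | yes (w , _) = w
  ... | no _        = v

  partner-≡ : ∀ {v w} → M v w ≡ true → partner v ≡ w
  partner-≡ {v} {w} e with any? (λ w → M v w Bool.≟ true)
  ... | yes (w′ , e′) = M-fun v w′ w e′ e
  ... | no ¬w         = ⊥-elim (¬w (w , e))

  matched-partner : ∀ {v} → Covered v → M v (partner v) ≡ true
  matched-partner {v} cv with M-covers v cv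
  ... | w , e = subst (λ x → M v x ≡ true) (sym (partner-≡ e)) e

  partner-involutive : ∀ {v} → Covered v → partner (partner v) ≡ v
  partner-involutive {v} cv = partner-≡ (trans (M-sym (partner v) v) (matched-partner cv))

  partner-adj : ∀ {v} → Covered v → adj G (partner v) v ≡ true
  partner-adj {v} cv = proj₁ (bipEdges⇒ G V₁ V₂ (M-bip _ _ (trans (M-sym (partner v) v) (matched-partner cv))))

  partner-V₂ : ∀ {v} → lookup V₂ v ≡ true → lookup V₁ (partner v) ≡ true
  partner-V₂ {v} e with proj₂ (bipEdges⇒ G V₁ V₂ (M-bip _ _ (matched-partner (V₂⇒Covered e))))
  ... | inj₁ (V₁v , _) = ⊥-elim (true≢false (trans (sym e) (disjoint v V₁v)))
  ... | inj₂ (_ , V₁w) = V₁w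

  bipEdges⇒Covered : ∀ {a b} → bipEdges G V₁ V₂ a b ≡ true → Covered b
  bipEdges⇒Covered {a} {b} e with proj₂ (bipEdges⇒ G V₁ V₂ e)
  ... | inj₁ (_ , V₂b) = V₂⇒Covered V₂b
  ... | inj₂ (_ , V₁b) = V₁⇒Covered V₁b

  -- Shifting M along the cycle C (v ↦ partner (τ v)) gives a second perfect matching of G[V₁ , V₂],
  -- so uniqueness forces σ to fix C.
  module Swap {C : Fin n → Set} (C? : Decidable C) (C⊆V₂ : ∀ {v} → C v → lookup V₂ v ≡ true)
              (σ τ : Fin n → Fin n)
              (σ-closed : ∀ {v} → C v → C (σ v)) (τ-closed : ∀ {v} → C v → C (τ v))
              (σ∘τ : ∀ {v} → C v → σ (τ v) ≡ v) (τ∘σ : ∀ {v} → C v → τ (σ v) ≡ v)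
              (σ-adj : ∀ {v} → C v → adj G (partner v) (σ v) ≡ true) where

    C⇒Covered : ∀ {v} → C v → Covered v
    C⇒Covered = V₂⇒Covered ∘ C⊆V₂

    partner-∉C : ∀ {v} → C v → ¬ C (partner v)
    partner-∉C cv cpv = true≢false (trans (sym (C⊆V₂ cpv)) (disjoint _ (partner-V₂ (C⊆V₂ cv))))

    partner⁻¹-C : ∀ {v} → C v → C (partner (partner v))
    partner⁻¹-C cv = subst C (sym (partner-involutive (C⇒Covered cv))) cv

    swap : Fin n → Fin n
    swap v with C? v | C? (partner v)
    ... | yes _ | _     = partner (τ v)
    ... | no _  | yes _ = σ (partner v)
    ... | no _  | no _  = partner v

    swap-into : ∀ {v} → ¬ C v → C (partner v) → swap v ≡ σ (partner v)
    swap-into {v} ¬cv cpv with C? v | C? (partner v)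
    ... | yes cv | _       = ⊥-elim (¬cv cv)
    ... | no _   | yes _   = refl
    ... | no _   | no ¬cpv = ⊥-elim (¬cpv cpv)

    swap-involutive : ∀ {v} → Covered v → swap (swap v) ≡ v
    swap-involutive {v} cv with C? v | C? (partner v)
    ... | yes c | _ = begin
      swap (partner (τ v))            ≡⟨ swap-into (partner-∉C (τ-closed c)) (partner⁻¹-C (τ-closed c)) ⟩
      σ (partner (partner (τ v)))     ≡⟨ cong σ (partner-involutive (C⇒Covered (τ-closed c))) ⟩
      σ (τ v)                         ≡⟨ σ∘τ c ⟩
      v                               ∎
      where open ≡-Reasoning
    ... | no ¬c | yes cp with C? (σ (partner v))
    ...   | yes _  = trans (cong partner (τ∘σ cp)) (partner-involutive cv)
    ...   | no ¬cσ = ⊥-elim (¬cσ (σ-closed cp))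
    swap-involutive {v} cv | no ¬c | no ¬cp
      with C? (partner v) | C? (partner (partner v))
    ... | yes cp′ | _     = ⊥-elim (¬cp cp′)
    ... | no _    | yes c = ⊥-elim (¬c (subst C (partner-involutive cv) c))
    ... | no _    | no _  = partner-involutive cv

    swap-bipartite : ∀ {v} → Covered v → bipEdges G V₁ V₂ v (swap v) ≡ true
    swap-bipartite {v} cv with C? v | C? (partner v)
    ... | yes c | _ =
      ⇒bipEdges₂₁ G V₁ V₂ (trans (adj-sym G v _) (subst (λ x → adj G (partner (τ v)) x ≡ true) (σ∘τ c) (σ-adj (τ-closed c))))
                  (C⊆V₂ c) (partner-V₂ (C⊆V₂ (τ-closed c)))
    ... | no _ | yes cp =
      ⇒bipEdges₁₂ G V₁ V₂ (subst (λ x → adj G x (σ (partner v)) ≡ true) (partner-involutive cv) (σ-adj cp))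
                  (subst (λ x → lookup V₁ x ≡ true) (partner-involutive cv) (partner-V₂ (C⊆V₂ cp)))
                  (C⊆V₂ (σ-closed cp))
    ... | no _ | no _ = M-bip v (partner v) (matched-partner cv)

    swapped : EdgeSet G
    swapped a b = (lookup V₁ a ∨ lookup V₂ a) ∧ does (swap a ≟ b)

    swapped⇒ : ∀ {a b} → swapped a b ≡ true → Covered a × swap a ≡ b
    swapped⇒ {a} {b} e = let ca , e′ = ∧-true e in ca , does-true (swap a ≟ b) e′

    ⇒swapped : ∀ {a} → Covered a → swapped a (swap a) ≡ true
    ⇒swapped {a} ca rewrite ca = dec-true (swap a ≟ swap a) refl

    swapped-perfect : IsPerfectMatching G V₁ V₂ swapped
    swapped-perfect = (swapped-sym , swapped-bip , swapped-fun) , λ v cv → swap v , ⇒swapped cv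
      where
      flip : ∀ a b → swapped a b ≡ true → swapped b a ≡ true
      flip a b e with swapped⇒ e
      ... | ca , refl = subst (λ x → swapped (swap a) x ≡ true) (swap-involutive ca)
                              (⇒swapped (bipEdges⇒Covered (swap-bipartite ca)))
      swapped-sym : ∀ a b → swapped a b ≡ swapped b a
      swapped-sym a b = true-≡ (flip a b) (flip b a)
      swapped-bip : ∀ a b → swapped a b ≡ true → bipEdges G V₁ V₂ a b ≡ true
      swapped-bip a b e with swapped⇒ e
      ... | ca , refl = swap-bipartite ca
      swapped-fun : ∀ a v w → swapped a v ≡ true → swapped a w ≡ true → v ≡ w
      swapped-fun a v w e e′ = trans (sym (proj₂ (swapped⇒ e))) (proj₂ (swapped⇒ e′))

    σ-fixes : ∀ {c} → C c → σ c ≡ c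
    σ-fixes {c} cc = M-fun (partner c) (σ c) c M-pσ (trans (M-sym (partner c) c) (matched-partner (C⇒Covered cc)))
      where
      swap-partner : swap (partner c) ≡ σ c
      swap-partner = trans (swap-into (partner-∉C cc) (partner⁻¹-C cc)) (cong σ (partner-involutive (C⇒Covered cc)))
      M-pσ : M (partner c) (σ c) ≡ true
      M-pσ = trans (sym (unique swapped swapped-perfect (partner c) (σ c)))
                   (subst (λ x → swapped (partner c) x ≡ true) swap-partner
                          (⇒swapped (V₁⇒Covered (partner-V₂ (C⊆V₂ cc)))))

  -- Iterating a choice of such w from u₀ reaches a periodic point, whose orbit is an alternating cycle.
  no-closed-set : ∀ {U : Fin n → Set} → Decidable U → (∀ {u} → U u → lookup V₂ u ≡ true) →
    (∀ u → U u → ∃ λ w → U w × adj G (partner u) w ≡ true × w ≢ u) → ∀ u → ¬ U u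
  no-closed-set {U} U? U⊆V₂ closed u₀ Uu₀ with choice U? closed
  ... | next , next-spec with periodic-point next u₀
  ...   | i , r , periodic = proj₂ (proj₂ (next-spec c (orbit-U c-in-orbit))) (σ-fixes c-in-orbit)
    where
    c : Fin n
    c = fold u₀ next i
    open Orbit next c r periodic
    c-in-orbit : InOrbit c
    c-in-orbit = 0 , refl
    iterate-U : ∀ k → U (fold u₀ next k)
    iterate-U zero    = Uu₀
    iterate-U (suc k) = proj₁ (next-spec _ (iterate-U k))
    orbit-U : ∀ {v} → InOrbit v → U v
    orbit-U (k , refl) = subst U (fold-+ u₀ next k) (iterate-U (k + i))
    open Swap (inOrbit? _≟_) (U⊆V₂ ∘ orbit-U) next back f-closed back-closed f∘back back∘f
              (λ o → proj₁ (proj₂ (next-spec _ (orbit-U o))))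
      using (σ-fixes)

  outside-V₂ : Subset n
  outside-V₂ = tabulate (not ∘ lookup V₂)

  UncolouredInV₂ : Subset n → Set
  UncolouredInV₂ C = ∀ v → lookup C v ≡ false → lookup V₂ v ≡ true

  partner-forces : ∀ C → UncolouredInV₂ C → (∀ v → lookup C v ≡ true) ⊎
    ∃₂ λ c u → LegalForce G outside-V₂ C c u × UncolouredInV₂ (C [ u ]≔ true)
  partner-forces C inV₂ with all? (λ v → lookup C v Bool.≟ true)
  ... | yes all = inj₁ all
  ... | no ¬all with any? (λ u → (lookup C u Bool.≟ false) ×-dec saturated? G C (partner u) u)
  ...   | yes (u , Cu , saturated) =
    inj₂ (partner u , u , (outside-partner , C-partner , Cu , partner-adj (V₂⇒Covered V₂u) , saturated) , inV₂′)
    where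
    V₂u : lookup V₂ u ≡ true
    V₂u = inV₂ u Cu
    V₂-partner : lookup V₂ (partner u) ≡ false
    V₂-partner = disjoint (partner u) (partner-V₂ V₂u)
    outside-partner : lookup outside-V₂ (partner u) ≡ true
    outside-partner = trans (lookup∘tabulate (not ∘ lookup V₂) (partner u)) (cong not V₂-partner)
    C-partner : lookup C (partner u) ≡ true
    C-partner = ¬-not λ C-false → true≢false (trans (sym (inV₂ (partner u) C-false)) V₂-partner)
    inV₂′ : UncolouredInV₂ (C [ u ]≔ true)
    inV₂′ v e = inV₂ v (proj₂ (≔true-false C u e))
  ...   | no ¬forceable = ⊥-elim (no-closed-set (λ u → lookup C u Bool.≟ false) (λ {u} → inV₂ u) closed u₀ (¬-not Cu₀))
    where
    closed : ∀ u → lookup C u ≡ false → ∃ λ w → lookup C w ≡ false × adj G (partner u) w ≡ true × w ≢ u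
    closed u Cu = let w , a , w≢u , Cw = unsaturated⇒ G C (partner u) u (λ sat → ¬forceable (u , Cu , sat))
                  in w , Cw , a , w≢u
    u₀ : Fin n
    u₀ = proj₁ (¬∀⟶∃¬ n _ (λ v → lookup C v Bool.≟ true) ¬all)
    Cu₀ : lookup C u₀ ≢ true
    Cu₀ = proj₂ (¬∀⟶∃¬ n _ (λ v → lookup C v Bool.≟ true) ¬all)

  outside-V₂-czfSet : IsCZFSet G outside-V₂
  outside-V₂-czfSet = zfRun-by-strategy G UncolouredInV₂ partner-forces outside-V₂
    (λ v e → not-injective (trans (sym (lookup∘tabulate (not ∘ lookup V₂) v)) e))

  ∣outside-V₂∣+esize : ∣ outside-V₂ ∣ + esize G M ≡ n
  ∣outside-V₂∣+esize = begin
    ∣ outside-V₂ ∣ + esize G M                    ≡⟨ cong₂ _+_ (∣tabulate∣≡count (not ∘ lookup V₂))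
                                                                (esize-perfect G {V₁} {V₂} disjoint perfect) ⟩
    count (not ∘ lookup V₂) + ∣ V₂ ∣             ≡⟨ cong (count (not ∘ lookup V₂) +_) (∣∣≡count V₂) ⟩
    count (not ∘ lookup V₂) + count (lookup V₂)  ≡⟨ count-not+count (lookup V₂) ⟩
    n                                            ∎
    where open ≡-Reasoning

uniqueness⇒czfSet : ∀ {n} (G : Graph n) {M} → HasUniqueness G M →
                    Σ (Subset n) λ S → IsCZFSet G S × ∣ S ∣ + esize G M ≡ n
uniqueness⇒czfSet G {M} (_ , V₁ , V₂ , disjoint , perfect , unique) =
  outside-V₂ , outside-V₂-czfSet , ∣outside-V₂∣+esize
  where open UniquelyMatched G {M} {V₁} {V₂} disjoint perfect unique

module _ {n : ℕ} (G : Graph n) where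

  zfRun⇒triangular : ∀ {S C} → (∀ v → lookup S v ≡ true → lookup C v ≡ true) → ZFRun G S C →
    Σ (List (Fin n × Fin n)) λ ps → Triangular G ps × length ps + ∣ C ∣ ≡ n ×
      All (λ (c , u) → lookup S c ≡ true × lookup C u ≡ false) ps
  zfRun⇒triangular {C = C} _ (done all) = [] , [] , ∣∣≡n C all , []
  zfRun⇒triangular {S} {C} S⊆C (force c u Sc Cc Cu cu others run)
    with zfRun⇒triangular (λ v → ≔true-mono C u ∘ S⊆C v) run
  ... | ps , t , len , later =
    (c , u) ∷ ps , cons cu (All.map precedes later) t , len′ , (Sc , Cu) ∷ All.map earlier later
    where
    C′ : Subset n
    C′ = C [ u ]≔ true
    len′ : suc (length ps) + ∣ C ∣ ≡ n
    len′ = trans (sym (+-suc (length ps) ∣ C ∣)) (trans (cong (length ps +_) (sym (∣≔true∣ C u Cu))) len)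
    precedes : ∀ {q} → lookup S (proj₁ q) ≡ true × lookup C′ (proj₂ q) ≡ false → Precedes G (c , u) q
    precedes {c′ , u′} (Sc′ , C′u′) = ¬-not c≁u′ , u′≢c , c′≢u
      where
      uncoloured-after : ∀ {v} → lookup C′ v ≡ true → v ≢ u′
      uncoloured-after C′v refl = true≢false (trans (sym C′v) C′u′)
      c≁u′ : adj G c u′ ≢ true
      c≁u′ a with u ≟ u′
      ... | yes refl = uncoloured-after (lookup∘update u C true) refl
      ... | no u≢u′  = uncoloured-after (≔true-mono C u (others u′ a (u≢u′ ∘ sym))) refl
      u′≢c : u′ ≢ c
      u′≢c refl = uncoloured-after (≔true-mono C u Cc) refl
      c′≢u : c′ ≢ u
      c′≢u refl = true≢false (trans (sym (S⊆C c′ Sc′)) Cu)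
    earlier : ∀ {q} → lookup S (proj₁ q) ≡ true × lookup C′ (proj₂ q) ≡ false →
                      lookup S (proj₁ q) ≡ true × lookup C (proj₂ q) ≡ false
    earlier {c′ , u′} (Sc′ , C′u′) = Sc′ , proj₂ (≔true-false C u C′u′)

module _ {n : ℕ} (G : Graph n) where

  sameEdge-here : ∀ u v → sameEdge G u v u v ≡ true
  sameEdge-here u v with u ≟ u | v ≟ v
  ... | yes _   | yes _   = refl
  ... | no u≢u  | _       = ⊥-elim (u≢u refl)
  ... | yes _   | no v≢v  = ⊥-elim (v≢v refl)

  sameEdge-there : ∀ u v → sameEdge G u v v u ≡ true
  sameEdge-there u v with v ≟ v | u ≟ u
  ... | yes _   | yes _   = ∨-zeroʳ _
  ... | no v≢v  | _       = ⊥-elim (v≢v refl)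
  ... | yes _   | no u≢u  = ⊥-elim (u≢u refl)

  sameEdge⇒ : ∀ {u v a b} → sameEdge G u v a b ≡ true → (a ≡ u × b ≡ v) ⊎ (a ≡ v × b ≡ u)
  sameEdge⇒ {u} {v} {a} {b} e with ∨-true e
  ... | inj₁ e₁ = let x , y = ∧-true e₁ in inj₁ (⌊⌋-true (a ≟ u) x , ⌊⌋-true (b ≟ v) y)
  ... | inj₂ e₂ = let x , y = ∧-true e₂ in inj₂ (⌊⌋-true (a ≟ v) x , ⌊⌋-true (b ≟ u) y)

  slid-occ : ∀ (o : Subset n) u v {x} → lookup ((o [ u ]≔ false) [ v ]≔ true) x ≡ true →
             x ≡ v ⊎ (x ≢ u × lookup o x ≡ true)
  slid-occ o u v {x} e with ≔true⇒ (o [ u ]≔ false) v e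
  ... | inj₁ refl = inj₁ refl
  ... | inj₂ e′ = let u≢x , ox = ≔false-true o u e′ in inj₂ (u≢x ∘ sym , ox)

  -- Along a search from S the cleared vertices evolve as a zero forcing colouring from S.
  record SearchInvariant (S : Subset n) (st : SState G) : Set where
    open SState st
    field
      inside-cleared   : ∀ a b → lookup S a ≡ true → lookup S b ≡ true → cle a b ≡ true
      cleared-occupied : ∀ v → lookup S v ≡ false → lookup clv v ≡ true → lookup occ v ≡ true
      unmoved-S        : ∀ v → lookup unm v ≡ true → lookup S v ≡ true
      unmoved-cleared  : ∀ v → lookup unm v ≡ true → lookup clv v ≡ true
      edge-ends        : ∀ a b → cle a b ≡ true → lookup clv a ≡ true × lookup clv b ≡ true
      occupied-cleared : ∀ v → lookup occ v ≡ true → lookup clv v ≡ true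

  module SlideStep {S o m cl : Subset n} {e : Fin n → Fin n → Bool} {u v : Fin n}
                   (f : SearchInvariant S (sstate o m cl e)) (mu : lookup m u ≡ true) where
    open SearchInvariant f

    o′ : Subset n
    o′ = (o [ u ]≔ false) [ v ]≔ true

    cl′ : Subset n
    cl′ = cl [ v ]≔ true

    unmoved-before : ∀ {x} → lookup (m [ u ]≔ false) x ≡ true → lookup m x ≡ true
    unmoved-before = proj₂ ∘ ≔false-true m u

    occupied-cleared′ : ∀ x → lookup o′ x ≡ true → lookup cl′ x ≡ true
    occupied-cleared′ x o′x with slid-occ o u v o′x
    ... | inj₁ refl     = lookup∘update v cl true
    ... | inj₂ (_ , ox) = ≔true-mono cl v (occupied-cleared x ox)

    cleared-occupied′ : ∀ x → lookup S x ≡ false → lookup cl′ x ≡ true → lookup o′ x ≡ true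
    cleared-occupied′ x Sx cl′x with ≔true⇒ cl v cl′x
    ... | inj₁ refl = lookup∘update v (o [ u ]≔ false) true
    ... | inj₂ clx  = ≔true-mono (o [ u ]≔ false) v
                        (trans (lookup∘update′ x≢u o false) (cleared-occupied x Sx clx))
      where
      x≢u : x ≢ u
      x≢u refl = true≢false (trans (sym (unmoved-S u mu)) Sx)

    edge-ends′ : ∀ a b → (e a b ∨ sameEdge G u v a b ∨ (lookup o′ a ∧ lookup o′ b)) ≡ true →
                 lookup cl′ a ≡ true × lookup cl′ b ≡ true
    edge-ends′ a b e′ with ∨-true e′
    ... | inj₁ eab = let x , y = edge-ends a b eab in ≔true-mono cl v x , ≔true-mono cl v y
    ... | inj₂ rest with ∨-true rest
    ...   | inj₂ occ = let x , y = ∧-true occ in occupied-cleared′ a x , occupied-cleared′ b y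
    ...   | inj₁ same with sameEdge⇒ {u} {v} {a} {b} same
    ...     | inj₁ (refl , refl) = ≔true-mono cl v (unmoved-cleared u mu) , lookup∘update v cl true
    ...     | inj₂ (refl , refl) = lookup∘update v cl true , ≔true-mono cl v (unmoved-cleared u mu)

    slide-invariant : SearchInvariant S (slideS G (sstate o m cl e) u v)
    slide-invariant = record
      { inside-cleared   = λ a b Sa Sb → ∨-introˡ _ (inside-cleared a b Sa Sb)
      ; cleared-occupied = cleared-occupied′
      ; unmoved-S        = λ x → unmoved-S x ∘ unmoved-before
      ; unmoved-cleared  = λ x → ≔true-mono cl v ∘ unmoved-cleared x ∘ unmoved-before
      ; edge-ends        = edge-ends′
      ; occupied-cleared = occupied-cleared′
      }

  searchRun⇒zfRun : ∀ {S st} → SearchInvariant S st → SRun G st → ZFRun G S (SState.clv st)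
  searchRun⇒zfRun f (done all _) = done all
  searchRun⇒zfRun {S} {sstate o m cl e} f (slide u v mu uv ov euv others run) =
    force u v (unmoved-S u mu) (unmoved-cleared u mu) cl-v uv saturated
          (searchRun⇒zfRun (SlideStep.slide-invariant f mu) run)
    where
    open SearchInvariant f
    S-v : lookup S v ≡ false
    S-v = ¬-not λ Sv → true≢false (trans (sym (inside-cleared u v (unmoved-S u mu) Sv)) euv)
    cl-v : lookup cl v ≡ false
    cl-v = ¬-not λ clv → true≢false (trans (sym (cleared-occupied v S-v clv)) ov)
    saturated : ∀ w → adj G u w ≡ true → w ≢ v → lookup cl w ≡ true
    saturated w uw w≢v = proj₂ (edge-ends u w (others w uw w≢v))

  cfmsStrategy⇒czfSet : ∀ {S} → IsCFMSStrategy G S → IsCZFSet G S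
  cfmsStrategy⇒czfSet {S} = searchRun⇒zfRun (record
    { inside-cleared   = λ a b Sa Sb → cong₂ _∧_ Sa Sb
    ; cleared-occupied = λ v Sv Sv′ → ⊥-elim (true≢false (trans (sym Sv′) Sv))
    ; unmoved-S        = λ _ Sv → Sv
    ; unmoved-cleared  = λ _ Sv → Sv
    ; edge-ends        = λ _ _ → ∧-true
    ; occupied-cleared = λ _ Sv → Sv
    })

  -- The state reached by replaying, as slides, the forces of a zero forcing run from S up to colouring C.
  record Simulates (S C : Subset n) (st : SState G) : Set where
    open SState st
    field
      cleared≡coloured      : ∀ v → lookup clv v ≡ lookup C v
      slid-saturated        : ∀ v → lookup S v ≡ true → lookup unm v ≡ false →
                              ∀ w → adj G v w ≡ true → lookup C w ≡ true
      uncoloured-empty      : ∀ v → lookup C v ≡ false → lookup occ v ≡ false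
      cleared-edge-ends     : ∀ a b → cle a b ≡ true → lookup C a ≡ true × lookup C b ≡ true
      coloured-edge-cleared : ∀ a b → adj G a b ≡ true → lookup C a ≡ true → lookup C b ≡ true → cle a b ≡ true
      vacated-slid          : ∀ v → lookup C v ≡ true → lookup occ v ≡ false →
                              lookup S v ≡ true × lookup unm v ≡ false

  module ForceStep {S C o m cl : Subset n} {e : Fin n → Fin n → Bool} {c u : Fin n}
                   (t : Simulates S C (sstate o m cl e)) (Sc : lookup S c ≡ true)
                   (Cc : lookup C c ≡ true) (Cu : lookup C u ≡ false) (cu : adj G c u ≡ true)
                   (others : Saturated G C c u) where
    open Simulates t

    C′ : Subset n
    C′ = C [ u ]≔ true

    o′ : Subset n
    o′ = (o [ c ]≔ false) [ u ]≔ true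

    C′u : lookup C′ u ≡ true
    C′u = lookup∘update u C true

    C′c : lookup C′ c ≡ true
    C′c = ≔true-mono C u Cc

    o′u : lookup o′ u ≡ true
    o′u = lookup∘update u (o [ c ]≔ false) true

    coloured≢u : ∀ {x} → lookup C x ≡ true → x ≢ u
    coloured≢u Cx refl = true≢false (trans (sym Cx) Cu)

    o′-elsewhere : ∀ {x} → x ≢ c → x ≢ u → lookup o′ x ≡ lookup o x
    o′-elsewhere x≢c x≢u = trans (lookup∘update′ x≢u (o [ c ]≔ false) true) (lookup∘update′ x≢c o false)

    unm′-elsewhere : ∀ {x} → x ≢ c → lookup (m [ c ]≔ false) x ≡ lookup m x
    unm′-elsewhere x≢c = lookup∘update′ x≢c m false

    coloured-occupied : ∀ {x} → lookup C x ≡ true → adj G x u ≡ true → lookup o x ≡ true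
    coloured-occupied {x} Cx xu = ¬-not λ ox → let Sx , mx = vacated-slid x Cx ox in
      true≢false (trans (sym (slid-saturated x Sx mx u xu)) Cu)

    cleared≡coloured′ : ∀ v → lookup (cl [ u ]≔ true) v ≡ lookup C′ v
    cleared≡coloured′ v with u ≟ v
    ... | yes refl = trans (lookup∘update u cl true) (sym C′u)
    ... | no u≢v   = trans (lookup∘update′ (u≢v ∘ sym) cl true)
                           (trans (cleared≡coloured v) (sym (lookup∘update′ (u≢v ∘ sym) C true)))

    slid-saturated′ : ∀ v → lookup S v ≡ true → lookup (m [ c ]≔ false) v ≡ false →
                      ∀ w → adj G v w ≡ true → lookup C′ w ≡ true
    slid-saturated′ v Sv m′v w vw with c ≟ v
    ... | no c≢v   = ≔true-mono C u (slid-saturated v Sv (trans (sym (unm′-elsewhere (c≢v ∘ sym))) m′v) w vw)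
    ... | yes refl with u ≟ w
    ...   | yes refl = C′u
    ...   | no u≢w   = ≔true-mono C u (others w vw (u≢w ∘ sym))

    uncoloured-empty′ : ∀ v → lookup C′ v ≡ false → lookup o′ v ≡ false
    uncoloured-empty′ v C′v with ≔true-false C u C′v
    ... | u≢v , Cv with c ≟ v
    ...   | yes refl = trans (lookup∘update′ (u≢v ∘ sym) (o [ c ]≔ false) true) (lookup∘update c o false)
    ...   | no c≢v   = trans (o′-elsewhere (c≢v ∘ sym) (u≢v ∘ sym)) (uncoloured-empty v Cv)

    occupied′-coloured : ∀ x → lookup o′ x ≡ true → lookup C′ x ≡ true
    occupied′-coloured x o′x with slid-occ o c u o′x
    ... | inj₁ refl     = C′u
    ... | inj₂ (_ , ox) = ≔true-mono C u (¬-not λ Cx → true≢false (trans (sym ox) (uncoloured-empty x Cx)))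

    cleared-edge-ends′ : ∀ a b → (e a b ∨ sameEdge G c u a b ∨ (lookup o′ a ∧ lookup o′ b)) ≡ true →
                         lookup C′ a ≡ true × lookup C′ b ≡ true
    cleared-edge-ends′ a b e′ with ∨-true e′
    ... | inj₁ eab = let x , y = cleared-edge-ends a b eab in ≔true-mono C u x , ≔true-mono C u y
    ... | inj₂ rest with ∨-true rest
    ...   | inj₂ occ = let x , y = ∧-true occ in occupied′-coloured a x , occupied′-coloured b y
    ...   | inj₁ same with sameEdge⇒ {c} {u} {a} {b} same
    ...     | inj₁ (refl , refl) = C′c , C′u
    ...     | inj₂ (refl , refl) = C′u , C′c

    coloured-edge-cleared′ : ∀ a b → adj G a b ≡ true → lookup C′ a ≡ true → lookup C′ b ≡ true →
                             (e a b ∨ sameEdge G c u a b ∨ (lookup o′ a ∧ lookup o′ b)) ≡ true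
    coloured-edge-cleared′ a b ab C′a C′b with ≔true⇒ C u C′a | ≔true⇒ C u C′b
    ... | inj₁ refl | inj₁ refl = ⊥-elim (true≢false (trans (sym ab) (irrefl G u)))
    ... | inj₂ Ca   | inj₂ Cb   = ∨-introˡ _ (coloured-edge-cleared a b ab Ca Cb)
    ... | inj₁ refl | inj₂ Cb with c ≟ b
    ...   | yes refl = ∨-introʳ (e u c) (∨-introˡ _ (sameEdge-there c u))
    ...   | no c≢b   = ∨-introʳ (e u b) (∨-introʳ (sameEdge G c u u b)
                         (cong₂ _∧_ o′u (trans (o′-elsewhere (c≢b ∘ sym) (coloured≢u Cb))
                                               (coloured-occupied Cb (trans (adj-sym G b u) ab)))))
    coloured-edge-cleared′ a b ab C′a C′b | inj₂ Ca | inj₁ refl with c ≟ a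
    ...   | yes refl = ∨-introʳ (e c u) (∨-introˡ _ (sameEdge-here c u))
    ...   | no c≢a   = ∨-introʳ (e a u) (∨-introʳ (sameEdge G c u a u)
                         (cong₂ _∧_ (trans (o′-elsewhere (c≢a ∘ sym) (coloured≢u Ca)) (coloured-occupied Ca ab)) o′u))

    vacated-slid′ : ∀ v → lookup C′ v ≡ true → lookup o′ v ≡ false →
                    lookup S v ≡ true × lookup (m [ c ]≔ false) v ≡ false
    vacated-slid′ v C′v o′v with u ≟ v
    ... | yes refl = ⊥-elim (true≢false (trans (sym o′u) o′v))
    ... | no u≢v with c ≟ v
    ...   | yes refl = Sc , lookup∘update c m false
    ...   | no c≢v   = let Sv , mv = vacated-slid v (trans (sym (lookup∘update′ (u≢v ∘ sym) C true)) C′v)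
                                       (trans (sym (o′-elsewhere (c≢v ∘ sym) (u≢v ∘ sym))) o′v)
                       in Sv , trans (unm′-elsewhere (c≢v ∘ sym)) mv

    simulates-force : Simulates S (C [ u ]≔ true) (slideS G (sstate o m cl e) c u)
    simulates-force = record
      { cleared≡coloured      = cleared≡coloured′
      ; slid-saturated        = slid-saturated′
      ; uncoloured-empty      = uncoloured-empty′
      ; cleared-edge-ends     = cleared-edge-ends′
      ; coloured-edge-cleared = coloured-edge-cleared′
      ; vacated-slid          = vacated-slid′
      }

  zfRun⇒searchRun : ∀ {S C st} → Simulates S C st → ZFRun G S C → SRun G st
  zfRun⇒searchRun t (done all) =
    done (λ v → trans (cleared≡coloured v) (all v)) (λ a b ab → coloured-edge-cleared a b ab (all a) (all b))
    where open Simulates t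
  zfRun⇒searchRun {S} {C} {sstate o m cl e} t (force c u Sc Cc Cu cu others run) =
    slide c u unmoved-c cu (uncoloured-empty u Cu) cu-contaminated
          (λ w cw w≢u → coloured-edge-cleared c w cw Cc (others w cw w≢u))
          (zfRun⇒searchRun (ForceStep.simulates-force t Sc Cc Cu cu others) run)
    where
    open Simulates t
    unmoved-c : lookup m c ≡ true
    unmoved-c = ¬-not λ mc → true≢false (trans (sym (slid-saturated c Sc mc u cu)) Cu)
    cu-contaminated : e c u ≡ false
    cu-contaminated = ¬-not λ ecu → true≢false (trans (sym (proj₂ (cleared-edge-ends c u ecu))) Cu)

  czfSet⇒cfmsStrategy : ∀ {S} → IsCZFSet G S → IsCFMSStrategy G S
  czfSet⇒cfmsStrategy {S} = zfRun⇒searchRun (record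
    { cleared≡coloured      = λ _ → refl
    ; slid-saturated        = λ v Sv Sv′ → ⊥-elim (true≢false (trans (sym Sv) Sv′))
    ; uncoloured-empty      = λ _ Sv → Sv
    ; cleared-edge-ends     = λ _ _ → ∧-true
    ; coloured-edge-cleared = λ a b _ Sa Sb → cong₂ _∧_ Sa Sb
    ; vacated-slid          = λ v Sv Sv′ → ⊥-elim (true≢false (trans (sym Sv) Sv′))
    })

module _ {n : ℕ} (G : Graph n) where

  firing-arithmetic : ∀ {k l e A B X Y} → k + 1 ≤ l + e → A + B ≤ X + Y →
                (k + A) + (1 + B) ≤ (l + X) + (e + Y)
  firing-arithmetic {k} {l} {e} {A} {B} {X} {Y} h₁ h₂ =
    subst₂ _≤_ (lhs k A B) (rhs l e X Y) (+-mono-≤ h₁ h₂)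
    where
    lhs : ∀ k A B → (k + 1) + (A + B) ≡ (k + A) + (1 + B)
    lhs = solve-∀
    rhs : ∀ l e X Y → (l + e) + (X + Y) ≡ (l + X) + (e + Y)
    rhs = solve-∀

  protectNbrs : Subset n → Fin n → Subset n
  protectNbrs P v = tabulate (λ w → lookup P w ∨ adj G v w)

  lookup-protectNbrs : ∀ P v w → lookup (protectNbrs P v) w ≡ (lookup P w ∨ adj G v w)
  lookup-protectNbrs P v = lookup∘tabulate (λ w → lookup P w ∨ adj G v w)

  positive⇒1≤ : ∀ {m} → positive G m ≡ true → 1 ≤ m
  positive⇒1≤ {suc _} _ = s≤s z≤n

  module Deduction (L : Vec ℕ n) where

    support : Subset n
    support = tabulate (positive G ∘ lookup L)

    unfiredMass : Subset n → ℕ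
    unfiredMass F = ∑ (λ v → if lookup F v then 0 else lookup L v)

    unfiredSupport : Subset n → ℕ
    unfiredSupport F = count (λ v → not (lookup F v) ∧ positive G (lookup L v))

    unfiredSupport≤unfiredMass : ∀ F → unfiredSupport F ≤ unfiredMass F
    unfiredSupport≤unfiredMass F = ∑-mono pointwise
      where
      pointwise : ∀ v → 𝟙 (not (lookup F v) ∧ positive G (lookup L v)) ≤ (if lookup F v then 0 else lookup L v)
      pointwise v with lookup F v | lookup L v
      ... | true  | _     = z≤n
      ... | false | zero  = z≤n
      ... | false | suc _ = s≤s z≤n

    fire-unfiredSupport : ∀ F v → lookup F v ≡ false → positive G (lookup L v) ≡ true →
                          unfiredSupport F ≡ 1 + unfiredSupport (F [ v ]≔ true)
    fire-unfiredSupport F v Fv pos = ∑-bump _ _ v at-v elsewhere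
      where
      at-v : 𝟙 (not (lookup F v) ∧ positive G (lookup L v)) ≡
             1 + 𝟙 (not (lookup (F [ v ]≔ true) v) ∧ positive G (lookup L v))
      at-v rewrite Fv | pos | lookup∘update v F true = refl
      elsewhere : ∀ j → j ≢ v → 𝟙 (not (lookup F j) ∧ positive G (lookup L j)) ≡
                                𝟙 (not (lookup (F [ v ]≔ true) j) ∧ positive G (lookup L j))
      elsewhere j j≢v rewrite lookup∘update′ j≢v F true = refl

    fire-unfiredMass : ∀ F v → lookup F v ≡ false → unfiredMass F ≡ lookup L v + unfiredMass (F [ v ]≔ true)
    fire-unfiredMass F v Fv = ∑-bump _ _ v at-v elsewhere
      where
      at-v : (if lookup F v then 0 else lookup L v) ≡ lookup L v + (if lookup (F [ v ]≔ true) v then 0 else lookup L v)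
      at-v rewrite Fv | lookup∘update v F true = sym (+-identityʳ (lookup L v))
      elsewhere : ∀ j → j ≢ v →
                  (if lookup F j then 0 else lookup L j) ≡ (if lookup (F [ v ]≔ true) j then 0 else lookup L j)
      elsewhere j j≢v rewrite lookup∘update′ j≢v F true = refl

    fire-unprotected : ∀ P v → ∣ P ∣ᶜ ≡ unprotNbrs G P v + ∣ protectNbrs P v ∣ᶜ
    fire-unprotected P v = begin
      ∣ P ∣ᶜ                                                ≡⟨ ∑-cong pointwise ⟩
      ∑ (λ w → 𝟙 (unprotected w) + 𝟙 (not (lookup P′ w)))  ≡⟨ ∑-distrib-+ (𝟙 ∘ unprotected) (𝟙 ∘ not ∘ lookup P′) ⟩
      count unprotected + ∣ P′ ∣ᶜ                           ≡⟨ cong (_+ ∣ P′ ∣ᶜ) (∣tabulate∣≡count unprotected) ⟨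
      unprotNbrs G P v + ∣ P′ ∣ᶜ                            ∎
      where
      open ≡-Reasoning
      P′ : Subset n
      P′ = protectNbrs P v
      unprotected : Fin n → Bool
      unprotected w = adj G v w ∧ not (lookup P w)
      pointwise : ∀ w → 𝟙 (not (lookup P w)) ≡ 𝟙 (unprotected w) + 𝟙 (not (lookup P′ w))
      pointwise w rewrite lookup-protectNbrs P v w with lookup P w | adj G v w
      ... | true  | true  = refl
      ... | true  | false = refl
      ... | false | true  = refl
      ... | false | false = refl

    -- Firing v protects at most lookup L v new vertices and, if it protects some w, the pair (v , w)
    -- extends the triangular sequence; hence this potential inequality survives every firing.
    Certificate : Subset n → Subset n → Set
    Certificate P F = Σ (List (Fin n × Fin n)) λ ps → Triangular G ps ×
      ∣ P ∣ᶜ + unfiredSupport F ≤ unfiredMass F + length ps ×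
      All (λ (c , u) → lookup support c ≡ true × lookup P u ≡ false) ps

    done-certificate : ∀ P F → (∀ v → lookup P v ≡ true) → Certificate P F
    done-certificate P F all = [] , [] , subst (_≤ unfiredMass F + 0) (cong (_+ unfiredSupport F) (sym none-unprotected))
      (subst (unfiredSupport F ≤_) (sym (+-identityʳ _)) (unfiredSupport≤unfiredMass F)) , []
      where
      none-unprotected : ∣ P ∣ᶜ ≡ 0
      none-unprotected = trans (∑-cong (λ v → cong (𝟙 ∘ not) (all v))) (sum-replicate-zero n)

    module Firing (P F : Subset n) (v : Fin n) (support⊆P : ∀ w → lookup support w ≡ true → lookup P w ≡ true)
                  (pos : positive G (lookup L v) ≡ true) (Fv : lookup F v ≡ false) where

      P′ : Subset n
      P′ = protectNbrs P v

      P′-false : ∀ {u} → lookup P′ u ≡ false → lookup P u ∨ adj G v u ≡ false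
      P′-false {u} P′u = trans (sym (lookup-protectNbrs P v u)) P′u

      fire-potential : ∀ {e ℓ} → unprotNbrs G P v + 1 ≤ lookup L v + e →
        ∣ P′ ∣ᶜ + unfiredSupport (F [ v ]≔ true) ≤ unfiredMass (F [ v ]≔ true) + ℓ →
        ∣ P ∣ᶜ + unfiredSupport F ≤ unfiredMass F + (e + ℓ)
      fire-potential {e} {ℓ} h ih′ = subst₂ _≤_
        (sym (cong₂ _+_ (fire-unprotected P v) (fire-unfiredSupport F v Fv pos)))
        (sym (cong (_+ _) (fire-unfiredMass F v Fv)))
        (firing-arithmetic {unprotNbrs G P v} {lookup L v} {e} {∣ P′ ∣ᶜ} {unfiredSupport (F [ v ]≔ true)}
                     {unfiredMass (F [ v ]≔ true)} {ℓ} h ih′)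

      earlier : ∀ {q} → lookup support (proj₁ q) ≡ true × lookup P′ (proj₂ q) ≡ false →
                        lookup support (proj₁ q) ≡ true × lookup P (proj₂ q) ≡ false
      earlier {c′ , u′} (sc′ , P′u′) = sc′ , ∨-conicalˡ (lookup P u′) (adj G v u′) (P′-false P′u′)

      fire-certificate : unprotNbrs G P v ≤ lookup L v → Certificate P′ (F [ v ]≔ true) → Certificate P F
      fire-certificate unp (ps , t , ih , later)
        with any? (λ w → adj G v w ∧ not (lookup P w) Bool.≟ true)
      ... | no none = ps , t , fire-potential budget ih , All.map earlier later
        where
        no-unprotected : unprotNbrs G P v ≡ 0
        no-unprotected = trans (∣tabulate∣≡count (λ w → adj G v w ∧ not (lookup P w)))
                               (trans (∑-cong (λ w → cong 𝟙 (¬-not (none ∘ (w ,_))))) (sum-replicate-zero n))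
        budget : unprotNbrs G P v + 1 ≤ lookup L v + 0
        budget rewrite no-unprotected = ≤-trans (positive⇒1≤ pos) (m≤m+n (lookup L v) 0)
      ... | yes (w , e) = (v , w) ∷ ps , cons vw (All.map precedes later) t , fire-potential (+-monoˡ-≤ 1 unp) ih ,
                          (trans (lookup∘tabulate (positive G ∘ lookup L) v) pos , Pw) ∷ All.map earlier later
        where
        vw : adj G v w ≡ true
        vw = proj₁ (∧-true e)
        Pw : lookup P w ≡ false
        Pw = not-injective (proj₂ (∧-true e))
        Pv : lookup P v ≡ true
        Pv = support⊆P v (trans (lookup∘tabulate (positive G ∘ lookup L) v) pos)
        precedes : ∀ {q} → lookup support (proj₁ q) ≡ true × lookup P′ (proj₂ q) ≡ false → Precedes G (v , w) q
        precedes {c′ , u′} (sc′ , P′u′) = v≁u′ , u′≢v , c′≢w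
          where
          P∨adj : lookup P u′ ∨ adj G v u′ ≡ false
          P∨adj = P′-false P′u′
          v≁u′ : adj G v u′ ≡ false
          v≁u′ = ∨-conicalʳ (lookup P u′) (adj G v u′) P∨adj
          u′≢v : u′ ≢ v
          u′≢v refl = true≢false (trans (sym Pv) (∨-conicalˡ (lookup P u′) (adj G v u′) P∨adj))
          c′≢w : c′ ≢ w
          c′≢w refl = true≢false (trans (sym (support⊆P c′ sc′)) Pw)

    dRun⇒certificate : ∀ {P F} → (∀ v → lookup support v ≡ true → lookup P v ≡ true) → DRun G L P F → Certificate P F
    dRun⇒certificate {P} {F} _ (done all) = done-certificate P F all
    dRun⇒certificate {P} {F} support⊆P (fire v pos Fv unp run) =
      Firing.fire-certificate P F v support⊆P pos Fv unp (dRun⇒certificate (λ w → grow w ∘ support⊆P w) run)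
      where
      grow : ∀ w → lookup P w ≡ true → lookup (protectNbrs P v) w ≡ true
      grow w Pw rewrite lookup-protectNbrs P v w | Pw = refl

    layout⇒triangular : IsDLayout G L → Σ (List (Fin n × Fin n)) λ ps → Triangular G ps × n ≤ Vec.sum L + length ps
    layout⇒triangular run with dRun⇒certificate (λ _ s → s) run
    ... | ps , t , bound , _ = ps , t , subst₂ _≤_ initial-count (cong (_+ length ps) initial-mass) bound
      where
      initial-count : ∣ support ∣ᶜ + unfiredSupport ∅ ≡ n
      initial-count = trans (cong (∣ support ∣ᶜ +_) (∑-cong (λ v → cong 𝟙 (supported v))))
                            (count-not+count (lookup support))
        where
        supported : ∀ v → not (lookup (∅ {n}) v) ∧ positive G (lookup L v) ≡ lookup support v
        supported v rewrite lookup-replicate v false = sym (lookup∘tabulate (positive G ∘ lookup L) v)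
      initial-mass : unfiredMass ∅ ≡ Vec.sum L
      initial-mass = trans (∑-cong (λ v → cong (if_then 0 else lookup L v) (lookup-replicate v false)))
                           (sym (sum≡∑lookup L))

  indicator : Subset n → Vec ℕ n
  indicator S = tabulate (𝟙 ∘ lookup S)

  sum-indicator : ∀ S → Vec.sum (indicator S) ≡ ∣ S ∣
  sum-indicator S = trans (sum-tabulate (𝟙 ∘ lookup S)) (sym (∣∣≡count S))

  positive-indicator : ∀ S v → positive G (lookup (indicator S) v) ≡ lookup S v
  positive-indicator S v rewrite lookup∘tabulate (𝟙 ∘ lookup S) v with lookup S v
  ... | true  = refl
  ... | false = refl

  zfRun⇒dRun : ∀ {S C P F} → (∀ v → lookup P v ≡ lookup C v) →
    (∀ v → lookup F v ≡ true → ∀ w → adj G v w ≡ true → lookup C w ≡ true) →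
    ZFRun G S C → DRun G (indicator S) P F
  zfRun⇒dRun P≡C _ (done all) = done (λ v → trans (P≡C v) (all v))
  zfRun⇒dRun {S} {C} {P} {F} P≡C fired-saturated (force c u Sc Cc Cu cu others run) =
    fire c (trans (positive-indicator S c) Sc) c-unfired at-most-one
         (zfRun⇒dRun P′≡C′ fired-saturated′ run)
    where
    C′ : Subset n
    C′ = C [ u ]≔ true
    P′ : Subset n
    P′ = protectNbrs P c
    c-unfired : lookup F c ≡ false
    c-unfired = ¬-not λ Fc → true≢false (trans (sym (fired-saturated c Fc u cu)) Cu)
    only-u : ∀ w → w ≢ u → 𝟙 (adj G c w ∧ not (lookup P w)) ≡ 0
    only-u w w≢u with adj G c w in cw
    ... | false = refl
    ... | true rewrite P≡C w | others w cw w≢u = refl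
    at-most-one : unprotNbrs G P c ≤ lookup (indicator S) c
    at-most-one = begin
      unprotNbrs G P c                          ≡⟨ ∣tabulate∣≡count (λ w → adj G c w ∧ not (lookup P w)) ⟩
      count (λ w → adj G c w ∧ not (lookup P w)) ≡⟨ ∑-single _ u only-u ⟩
      𝟙 (adj G c u ∧ not (lookup P u))          ≤⟨ 𝟙≤1 _ ⟩
      1                                         ≡⟨ cong 𝟙 Sc ⟨
      𝟙 (lookup S c)                            ≡⟨ lookup∘tabulate (𝟙 ∘ lookup S) c ⟨
      lookup (indicator S) c                    ∎
      where open ≤-Reasoning
    P′≡C′ : ∀ v → lookup P′ v ≡ lookup C′ v
    P′≡C′ v = trans (lookup-protectNbrs P c v) (true-≡ ⇒C′ ⇒P′)
      where
      ⇒C′ : lookup P v ∨ adj G c v ≡ true → lookup C′ v ≡ true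
      ⇒C′ e with ∨-true e | u ≟ v
      ... | _          | yes refl = lookup∘update u C true
      ... | inj₁ Pv    | no _     = ≔true-mono C u (trans (sym (P≡C v)) Pv)
      ... | inj₂ cv    | no u≢v   = ≔true-mono C u (others v cv (u≢v ∘ sym))
      ⇒P′ : lookup C′ v ≡ true → lookup P v ∨ adj G c v ≡ true
      ⇒P′ e with ≔true⇒ C u e
      ... | inj₁ refl = ∨-introʳ (lookup P u) cu
      ... | inj₂ Cv   = ∨-introˡ _ (trans (P≡C v) Cv)
    fired-saturated′ : ∀ v → lookup (F [ c ]≔ true) v ≡ true → ∀ w → adj G v w ≡ true → lookup C′ w ≡ true
    fired-saturated′ v e w vw with ≔true⇒ F c e
    ... | inj₂ Fv = ≔true-mono C u (fired-saturated v Fv w vw)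
    ... | inj₁ refl with u ≟ w
    ...   | yes refl = lookup∘update u C true
    ...   | no u≢w   = ≔true-mono C u (others w vw (u≢w ∘ sym))

  czfSet⇒dLayout : ∀ {S} → IsCZFSet G S → IsDLayout G (indicator S)
  czfSet⇒dLayout {S} = zfRun⇒dRun (λ v → trans (lookup∘tabulate _ v) (positive-indicator S v))
                               (λ v ∅v → ⊥-elim (true≢false (trans (sym ∅v) (lookup-replicate v false))))

module _ {n : ℕ} (G : Graph n) where

  czf≤n : ∀ {k} → IsCZF G k → k ≤ n
  czf≤n ((S , _ , refl) , _) = ∣p∣≤n S

  matching-bound : ∀ {k} → IsCZF G k → ∀ M → HasUniqueness G M → esize G M ≤ n ∸ k
  matching-bound {k} (_ , least) M hu with uniqueness⇒czfSet G hu
  ... | S , zf , size = subst (_≤ n ∸ k) n∸∣S∣≡esize (∸-monoʳ-≤ n (least S zf))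
    where
    n∸∣S∣≡esize : n ∸ ∣ S ∣ ≡ esize G M
    n∸∣S∣≡esize = trans (cong (_∸ ∣ S ∣) (trans (sym size) (+-comm ∣ S ∣ (esize G M))))
                        (m+n∸n≡m (esize G M) ∣ S ∣)

  triangular-bound : ∀ {k ps} → IsCZF G k → Triangular G ps → length ps ≤ n ∸ k
  triangular-bound {k} czf t = subst (_≤ n ∸ k) (esize-triangular G t) (matching-bound czf _ (triangular-uniqueness G t))

  czf⇒mu : ∀ {k} → IsCZF G k → IsMU G (n ∸ k)
  czf⇒mu czf@((S , zf , refl) , _) with zfRun⇒triangular G (λ _ s → s) zf
  ... | ps , t , len , _ =
    (matchingOf G ps , triangular-uniqueness G t ,
     trans (esize-triangular G t) (trans (sym (m+n∸n≡m (length ps) ∣ S ∣)) (cong (_∸ ∣ S ∣) len))) ,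
    matching-bound czf

  czf⇒cfms : ∀ {k} → IsCZF G k → IsCFMS G k
  czf⇒cfms ((S , zf , size) , least) =
    (S , czfSet⇒cfmsStrategy G zf , size) , λ S′ strategy → least S′ (cfmsStrategy⇒czfSet G strategy)

  czf⇒d : ∀ {k} → IsCZF G k → IsD G k
  czf⇒d {k} czf@((S , zf , size) , _) =
    (indicator G S , czfSet⇒dLayout G zf , trans (sum-indicator G S) size) , lower
    where
    lower : ∀ L → IsDLayout G L → k ≤ Vec.sum L
    lower L layout with Deduction.layout⇒triangular G L layout
    ... | ps , t , n≤ = ≤-from-budget (czf≤n czf) n≤ (triangular-bound czf t)

mainTheorem4 : ∀ {n : ℕ} (G : Graph n) → Connected G →
    Σ ℕ (λ m → IsMU G m × IsCZF G (n ∸ m) × IsCFMS G (n ∸ m) × IsD G (n ∸ m))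
mainTheorem4 {n} G _ with czf-attained G
... | k , czf =
  n ∸ k , czf⇒mu G czf , via (IsCZF G) czf , via (IsCFMS G) (czf⇒cfms G czf) , via (IsD G) (czf⇒d G czf)
  where
  via : (P : ℕ → Set) → P k → P (n ∸ (n ∸ k))
  via P = subst P (sym (m∸[m∸n]≡n (czf≤n G czf)))
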